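{- For every integer $d\ge 3$ there is a constant $C(d)>0$ such that for every integer $m\ge1$ and $p\in(0,1)$ the following holds. Let each vertex of $[2m]^d$ be initially infected independently with probability $p$ and partition $[2m]^d$ into the $2^d$ subcubes $\prod_{i=1}^d\{a_i,\dots,a_i+m-1\}$, $a_i\in\{1,m+1\}$. Let $E^d$ be the event that $[2m]^d$ is good and $A^d$ the event that all $2^d$ subcubes are good (with infection threshold $d$). Then $$\mathbb{P}\big((E^d)^c\cap A^d\big)\le C(d)(1-p)^{4m}.$$
   Context: Grid adjacency is nearest-neighbour ($\ell_1$-distance $1$). For a cube $D$ of side length $k$ (a translate of $[k]^d$), a side of $D$ is a line segment in $D$ along which one coordinate varies over its full range while every other coordinate is fixed at its minimum or maximum value in $D$. The interior of $D$ is $D$ minus the union of its sides. With $A$ the initially infected set, $[D\cap A]$ is the final infected set of the $r$-neighbour bootstrap percolation process (a vertex becomes infected once it has at least $r$ infected neighbours; infected vertices stay infected) started from $D\cap A$ on the subgraph induced by $D$. $D$ is good if its interior is contained in $[D\cap A]$, and bad otherwise. Here $r=d$.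
   Formalization: The infection probability p ranges only over rational values in (0,1), and the constant C(d) is taken in the rationals. -}

module Defs where

open import Data.Bool using (Bool; true; false; _∧_; _∨_; not; if_then_else_)
open import Data.Nat using (ℕ; zero; suc; _∸_; _≤ᵇ_; ∣_-_∣)
open import Data.Nat.Properties using () renaming (_≟_ to _≟ℕ_)
open import Data.Fin using (Fin; _≟_)
open import Data.List using (List; []; _∷_; [_]; map; concatMap; upTo; length; filter; foldr; allFin; _++_)
open import Data.Bool.ListAction using (any; all)
open import Data.Vec using (Vec; []; _∷_; lookup; replicate; zipWith)
open import Data.Vec.Properties using (≡-dec)
open import Data.Rational using (ℚ; 0ℚ; 1ℚ) renaming (_*_ to _*ℚ_; _+_ to _+ℚ_; _-_ to _-ℚ_)
open import Relation.Nullary.Decidable using (⌊_⌋)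

-- Points of ℤ^d with positive coordinates, as vectors of naturals.
Pt : ℕ → Set
Pt d = Vec ℕ d

range : ℕ → ℕ → List ℕ
range a k = map (a Data.Nat.+_) (upTo k)

cubePts : ∀ {d} → Vec ℕ d → ℕ → List (Pt d)
cubePts [] k = [ [] ]
cubePts (a ∷ as) k = concatMap (λ x → map (x ∷_) (cubePts as k)) (range a k)

memb : ∀ {d} → Pt d → List (Pt d) → Bool
memb x [] = false
memb x (y ∷ ys) = ⌊ ≡-dec _≟ℕ_ x y ⌋ ∨ memb x ys

l1 : ∀ {d} → Pt d → Pt d → ℕ
l1 x y = Data.Vec.foldr _ Data.Nat._+_ 0 (zipWith ∣_-_∣ x y)

adj : ∀ {d} → Pt d → Pt d → Bool
adj x y = ⌊ l1 x y ≟ℕ 1 ⌋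

count : ∀ {A : Set} → (A → Bool) → List A → ℕ
count P [] = 0
count P (x ∷ xs) = if P x then suc (count P xs) else count P xs

step : ∀ {d} → ℕ → List (Pt d) → (Pt d → Bool) → (Pt d → Bool)
step r D inf x = inf x ∨ (memb x D ∧ (r ≤ᵇ count (λ y → adj x y ∧ inf y) D))

iter : ∀ {d} → ℕ → ℕ → List (Pt d) → (Pt d → Bool) → (Pt d → Bool)
iter r zero D inf = inf
iter r (suc n) D inf = iter r n D (step r D inf)

-- [D ∩ S]: final infected set of r-neighbour bootstrap percolation on D started
-- from D ∩ S.  The process is monotone and stabilises after at most |D| steps.
closure : ∀ {d} → ℕ → List (Pt d) → List (Pt d) → (Pt d → Bool)
closure r D S = iter r (length D) D (λ x → memb x D ∧ memb x S)

-- x lies on a side of the cube with min corner a and side length k: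
-- some coordinate i such that all other coordinates are at min or max.
atExtreme : ℕ → ℕ → ℕ → Bool
atExtreme a k y = ⌊ y ≟ℕ a ⌋ ∨ ⌊ y ≟ℕ (a Data.Nat.+ k ∸ 1) ⌋

onSide : ∀ {d} → Vec ℕ d → ℕ → Pt d → Bool
onSide {d} a k x =
  any (λ i → all (λ j → ⌊ i ≟ j ⌋ ∨ atExtreme (lookup a j) k (lookup x j)) (allFin d)) (allFin d)

interior : ∀ {d} → Vec ℕ d → ℕ → Pt d → Bool
interior a k x = memb x (cubePts a k) ∧ not (onSide a k x)

good : ∀ {d} → ℕ → Vec ℕ d → ℕ → List (Pt d) → Bool
good r a k S = all (λ x → not (interior a k x) ∨ closure r (cubePts a k) S x) (cubePts a k)

corners : (d : ℕ) → ℕ → List (Vec ℕ d)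
corners zero m = [ [] ]
corners (suc d) m = map (1 ∷_) (corners d m) ++ map (suc m ∷_) (corners d m)

grid : (d m : ℕ) → List (Pt d)
grid d m = cubePts (replicate d 1) (2 Data.Nat.* m)

badEvent : (d m : ℕ) → List (Pt d) → Bool
badEvent d m S = not (good d (replicate d 1) (2 Data.Nat.* m) S)
               ∧ all (λ a → good d a m S) (corners d m)

subsets : ∀ {A : Set} → List A → List (List A)
subsets [] = [ [] ]
subsets (x ∷ xs) = map (x ∷_) (subsets xs) ++ subsets xs

pow : ℚ → ℕ → ℚ
pow q zero = 1ℚ
pow q (suc n) = q *ℚ pow q n

-- probability of an event under the product measure: each point of V is in the
-- initial set independently with probability p
prob : ∀ {d} → ℚ → List (Pt d) → (List (Pt d) → Bool) → ℚ
prob p V ev = foldr _+ℚ_ 0ℚ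
  (map (λ S → if ev S then pow p (length S) *ℚ pow (1ℚ -ℚ p) (length V ∸ length S) else 0ℚ)
       (subsets V))

{-# OPTIONS --safe #-}
-- If all 2^d subcubes of [2m]^d are good, every vertex with two coordinates each strictly inside a half,
-- {2, …, m − 1} or {m + 2, …, 2m − 1}, lies inside its subcube and is infected. So for m ≥ 3 a
-- vertex with one such coordinate already has d − 1 infected neighbours (move another coordinate
-- inward): it is infected as soon as one more neighbour is. Starting from an uninfected interior vertex
-- of [2m]^d, this propagates non-infection along lines through the side values 1, m, m + 1, 2m until two
-- adjacent parallel lines of length 2m are entirely uninfected, hence not initially infected. There are at
-- most d² 4^d such pairs of lines, each with 4m vertices, and the union bound gives C (1 − p)^{4m}.
-- For m = 2 the subcubes have no interior; instead an uninfected vertex with k coordinates in {2, 3}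
-- has at least k + 1 uninfected neighbours, and a parity count (k ≥ 3) or a case analysis in the plane
-- of its two middle coordinates (k = 2) gives 8 = 4m uninfected vertices. For m = 1 the cube has no
-- interior.
module Submission where

module BootstrapPercolation where

  open import Algebra.Bundles using (CommutativeMonoid)
  import Algebra.Properties.CommutativeSemigroup as CommSemigroupProperties
  open import Data.Bool using (Bool; true; false; _∧_; _∨_; _xor_; not; if_then_else_)
  open import Data.Bool.ListAction using (all; any)
  open import Data.Bool.Properties
    using (∨-identityʳ; ∨-zeroʳ; ∧-zeroʳ; ∧-conicalˡ; ∧-conicalʳ; ∨-conicalˡ; ∨-conicalʳ; ¬-not; T-≡;
           not-distribˡ-xor; not-distribʳ-xor; not-¬; not-involutive)
    renaming (_≟_ to _≟ᵇ_)
  open import Data.Empty using (⊥-elim)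
  open import Data.Fin as Fin using (Fin; zero; suc)
  import Data.Fin.Properties as Fin
  import Data.Integer as ℤ
  open import Data.List
    using (List; []; _∷_; _++_; length; map; filter; allFin; concatMap; cartesianProductWith;
           cartesianProduct; tabulate; foldr; upTo)
  open import Data.List.Membership.Propositional using (_∈_; find)
  open import Data.List.Membership.Propositional.Properties
    using (∈-∃++; ∈-++⁻; ∈-++⁺ˡ; ∈-++⁺ʳ; ∈-filter⁺; ∈-filter⁻; ∈-map⁺; ∈-map⁻; ∈-upTo⁺; ∈-upTo⁻;
           ∈-cartesianProductWith⁺; ∈-cartesianProductWith⁻; ∈-cartesianProduct⁺; ∈-tabulate⁻; ∈-allFin)
  open import Data.List.Properties using (length-tabulate; length-++; length-map; length-upTo; map-++; map-∘)
  open import Data.List.Relation.Binary.Subset.Propositional using (_⊆_)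
  open import Data.List.Relation.Unary.All as All using (All; all?)
  open import Data.List.Relation.Unary.All.Properties using (¬All⇒Any¬)
  open import Data.List.Relation.Unary.AllPairs as AllPairs using (_∷_)
  open import Data.List.Relation.Unary.Any using (here; there)
  open import Data.List.Relation.Unary.Unique.Propositional using (Unique)
  import Data.List.Relation.Unary.Unique.Propositional.Properties as Unique
  import Data.List.Relation.Unary.Unique.DecPropositional as UniqueDec
  open import Data.Nat using (ℕ; zero; suc; pred; _+_; _*_; _∸_; _≤_; _<_; z≤n; s≤s; _≤ᵇ_; ∣_-_∣)
  open import Data.Nat.Properties
  open import Data.Product using (∃-syntax; _×_; _,_; proj₁; proj₂)
  import Data.Product.Properties as Product
  open import Data.Rational using (ℚ; 0ℚ; 1ℚ)
  import Data.Rational as ℚ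
  import Data.Rational.Properties as ℚ
  open import Data.Sum using (_⊎_; inj₁; inj₂; [_,_]′)
  import Data.Sum
  open import Data.Vec as Vec using (Vec; []; _∷_; lookup; replicate; _[_]≔_)
  open import Data.Vec.Properties
    using (≡-dec; ∷-injective; lookup-replicate; lookup∘update; lookup∘update′; lookup-map; map-[]≔;
           []≔-idempotent; []≔-lookup; []≔-commutes; tabulate∘lookup; tabulate-cong)
  open import Defs
  open import Function using (_∘_; Equivalence)
  open import Relation.Binary.PropositionalEquality
  open import Relation.Nullary using (¬_; Dec; yes; no; contradiction)
  open import Relation.Nullary.Decidable
    using (⌊_⌋; ¬?; map′; from-yes; dec-false; isYes≗does; _×-dec_; decidable-stable)

  private variable
    d : ℕ

  module _ {A : Set} where

    count-≤-length : (P : A → Bool) (xs : List A) → count P xs ≤ length xs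
    count-≤-length P [] = z≤n
    count-≤-length P (x ∷ xs) with P x
    ... | true  = s≤s (count-≤-length P xs)
    ... | false = m≤n⇒m≤1+n (count-≤-length P xs)

    count-mono : {P Q : A → Bool} → (∀ x → P x ≡ true → Q x ≡ true) →
                 ∀ xs → count P xs ≤ count Q xs
    count-mono h [] = z≤n
    count-mono {P} {Q} h (x ∷ xs) with P x in px | Q x in qx
    ... | true  | true  = s≤s (count-mono h xs)
    ... | true  | false = contradiction (trans (sym (h x px)) qx) λ ()
    ... | false | true  = m≤n⇒m≤1+n (count-mono h xs)
    ... | false | false = count-mono h xs

    count-cong : {P Q : A → Bool} → (∀ x → P x ≡ Q x) → ∀ xs → count P xs ≡ count Q xs
    count-cong h xs = ≤-antisym (count-mono (λ x e → trans (sym (h x)) e) xs)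
                                (count-mono (λ x e → trans (h x) e) xs)

    count-mono-< : {P Q : A → Bool} → (∀ x → P x ≡ true → Q x ≡ true) →
                   ∀ {z xs} → z ∈ xs → P z ≡ false → Q z ≡ true → count P xs < count Q xs
    count-mono-< {P} {Q} h {xs = x ∷ xs} (here refl) pz qz rewrite pz | qz = s≤s (count-mono h xs)
    count-mono-< {P} {Q} h {xs = x ∷ xs} (there z∈xs) pz qz with P x in px | Q x in qx
    ... | true  | true  = s≤s (count-mono-< h z∈xs pz qz)
    ... | true  | false = contradiction (trans (sym (h x px)) qx) λ ()
    ... | false | true  = m≤n⇒m≤1+n (count-mono-< h z∈xs pz qz)
    ... | false | false = count-mono-< h z∈xs pz qz

    count-++ : (P : A → Bool) (xs ys : List A) → count P (xs ++ ys) ≡ count P xs + count P ys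
    count-++ P []       ys = refl
    count-++ P (x ∷ xs) ys with P x
    ... | true  = cong suc (count-++ P xs ys)
    ... | false = count-++ P xs ys

    count-map : ∀ {B : Set} (P : B → Bool) (f : A → B) (xs : List A) → count P (map f xs) ≡ count (P ∘ f) xs
    count-map P f []       = refl
    count-map P f (x ∷ xs) with P (f x)
    ... | true  = cong suc (count-map P f xs)
    ... | false = count-map P f xs

    count-≥2 : (P : A → Bool) {x y z : A} → P x ≡ true → P y ≡ true ⊎ P z ≡ true →
               2 ≤ count P (x ∷ y ∷ z ∷ [])
    count-≥2 P {x} {y} {z} px (inj₁ py) rewrite px | py = s≤s (s≤s z≤n)
    count-≥2 P {x} {y} {z} px (inj₂ pz) rewrite px | pz with P y
    ... | true  = s≤s (s≤s z≤n)
    ... | false = s≤s (s≤s z≤n)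

    count-≥3 : (P : A → Bool) {x y z : A} → P x ≡ true → P y ≡ true → P z ≡ true →
               3 ≤ count P (x ∷ y ∷ z ∷ [])
    count-≥3 P px py pz rewrite px | py | pz = ≤-refl

    count+count-not : (P : A → Bool) (xs : List A) → count P xs + count (not ∘ P) xs ≡ length xs
    count+count-not P [] = refl
    count+count-not P (x ∷ xs) with P x
    ... | true  = cong suc (count+count-not P xs)
    ... | false = trans (+-suc _ _) (cong suc (count+count-not P xs))

    count≡length-filter : (P : A → Bool) (xs : List A) →
                          count P xs ≡ length (filter (λ x → P x ≟ᵇ true) xs)
    count≡length-filter P [] = refl
    count≡length-filter P (x ∷ xs) with P x
    ... | true  = cong suc (count≡length-filter P xs)
    ... | false = count≡length-filter P xs

    length-mono-⊆ : {xs ys : List A} → Unique xs → xs ⊆ ys → length xs ≤ length ys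
    length-mono-⊆ {[]} _ _ = z≤n
    length-mono-⊆ {x ∷ xs} {ys} (x∉xs ∷ uxs) sub with ∈-∃++ (sub (here refl))
    ... | (ys₁ , ys₂ , refl) = begin
      suc (length xs)                 ≤⟨ s≤s (length-mono-⊆ uxs sub′) ⟩
      suc (length (ys₁ ++ ys₂))       ≡⟨ cong suc (length-++ ys₁) ⟩
      suc (length ys₁ + length ys₂)   ≡⟨ +-suc (length ys₁) (length ys₂) ⟨
      length ys₁ + length (x ∷ ys₂)   ≡⟨ length-++ ys₁ ⟨
      length (ys₁ ++ x ∷ ys₂)         ∎
      where
        open ≤-Reasoning
        sub′ : xs ⊆ ys₁ ++ ys₂
        sub′ {y} y∈xs with ∈-++⁻ ys₁ (sub (there y∈xs))
        ... | inj₁ y∈ys₁ = ∈-++⁺ˡ y∈ys₁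
        ... | inj₂ (here refl) = ⊥-elim (All.lookup x∉xs y∈xs refl)
        ... | inj₂ (there y∈ys₂) = ∈-++⁺ʳ ys₁ y∈ys₂

    length≤count : {P : A → Bool} {xs ys : List A} → Unique xs → xs ⊆ ys →
                     (∀ {x} → x ∈ xs → P x ≡ true) → length xs ≤ count P ys
    length≤count {P} {xs} {ys} uxs sub px = subst (length xs ≤_) (sym (count≡length-filter P ys))
      (length-mono-⊆ uxs (λ x∈xs → ∈-filter⁺ (λ x → P x ≟ᵇ true) (sub x∈xs) (px x∈xs)))

    count-mono-⊆ : (P : A → Bool) {xs ys : List A} → Unique xs → xs ⊆ ys → count P xs ≤ count P ys
    count-mono-⊆ P {xs} uxs sub = subst (_≤ _) (sym (count≡length-filter P xs))
      (length≤count (Unique.filter⁺ P? uxs) (sub ∘ proj₁ ∘ ∈-filter⁻ P? {xs = xs})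
                    (proj₂ ∘ ∈-filter⁻ P? {xs = xs}))
      where P? = λ x → P x ≟ᵇ true

  memb⇒∈ : {x : Pt d} (ys : List (Pt d)) → memb x ys ≡ true → x ∈ ys
  memb⇒∈ {x = x} (y ∷ ys) e with ≡-dec _≟_ x y
  ... | yes x≡y = here x≡y
  ... | no _    = there (memb⇒∈ ys e)

  ∈⇒memb : {x : Pt d} {ys : List (Pt d)} → x ∈ ys → memb x ys ≡ true
  ∈⇒memb {x = x} {y ∷ ys} x∈ with ≡-dec _≟_ x y | x∈
  ... | yes _ | _          = refl
  ... | no x≢y | here x≡y  = contradiction x≡y x≢y
  ... | no _  | there x∈ys = ∈⇒memb x∈ys

  not-true⇒false : ∀ {b} → not b ≡ true → b ≡ false
  not-true⇒false {false} _ = refl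

  not-false⇒true : ∀ {b} → not b ≡ false → b ≡ true
  not-false⇒true {true} _ = refl

  ⌊⌋-false : ∀ {P : Set} (P? : Dec P) → ¬ P → ⌊ P? ⌋ ≡ false
  ⌊⌋-false P? ¬p = trans (isYes≗does P?) (dec-false P? ¬p)

  ≤⇒≤ᵇ′ : ∀ {a b} → a ≤ b → (a ≤ᵇ b) ≡ true
  ≤⇒≤ᵇ′ a≤b = Equivalence.to T-≡ (≤⇒≤ᵇ a≤b)

  -- Bootstrap percolation

  Closed : ℕ → List (Pt d) → (Pt d → Bool) → Set
  Closed r D J = ∀ x → x ∈ D → r ≤ count (λ y → adj x y ∧ J y) D → J x ≡ true

  Closed-⊆ : ∀ {r} {D D′ : List (Pt d)} {J} → Unique D′ → D′ ⊆ D → Closed r D J → Closed r D′ J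
  Closed-⊆ uD′ sub closed x x∈D′ r≤ = closed x (sub x∈D′) (≤-trans r≤ (count-mono-⊆ _ uD′ sub))

  module Bootstrap {d : ℕ} (r : ℕ) (D : List (Pt d)) where

    Stable : (Pt d → Bool) → Set
    Stable f = step r D f ≗ f

    step-cong : ∀ {f g} → f ≗ g → step r D f ≗ step r D g
    step-cong {f} {g} f≗g x rewrite f≗g x
      | count-cong (λ y → cong (adj x y ∧_) (f≗g y)) D = refl

    iter-suc : ∀ f n → iter r (suc n) D f ≗ step r D (iter r n D f)
    iter-suc f zero    x = refl
    iter-suc f (suc n) x = iter-suc (step r D f) n x

    step-inflationary : ∀ f x → f x ≡ true → step r D f x ≡ true
    step-inflationary f x fx rewrite fx = refl

    iter-inflationary : ∀ f n x → f x ≡ true → iter r n D f x ≡ true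
    iter-inflationary f zero    x fx = fx
    iter-inflationary f (suc n) x fx = iter-inflationary (step r D f) n x (step-inflationary f x fx)

    Stable-resp : ∀ {f g} → f ≗ g → Stable f → Stable g
    Stable-resp f≗g st x = trans (step-cong (sym ∘ f≗g) x) (trans (st x) (f≗g x))

    stable⇒closed : ∀ {f} → Stable f → Closed r D f
    stable⇒closed {f} st x x∈D r≤ = begin
      f x                                                      ≡⟨ st x ⟨
      f x ∨ (memb x D ∧ (r ≤ᵇ count (λ y → adj x y ∧ f y) D))
        ≡⟨ cong₂ (λ a b → f x ∨ (a ∧ b)) (∈⇒memb x∈D) (≤⇒≤ᵇ′ r≤) ⟩
      f x ∨ true                                               ≡⟨ ∨-zeroʳ (f x) ⟩
      true                                                     ∎
      where open ≡-Reasoning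

    stable-or-grows : ∀ f → Stable f ⊎ count f D < count (step r D f) D
    stable-or-grows f with all? (λ x → step r D f x ≟ᵇ f x) D
    ... | yes fixed = inj₁ λ x → on-or-off x (memb x D) refl
      where
        on-or-off : ∀ x b → memb x D ≡ b → step r D f x ≡ f x
        on-or-off x true  e = All.lookup fixed (memb⇒∈ D e)
        on-or-off x false e rewrite e = ∨-identityʳ (f x)
    ... | no moving with find (¬All⇒Any¬ (λ x → step r D f x ≟ᵇ f x) D moving)
    ... | (x , x∈D , changed) = inj₂ (count-mono-< (step-inflationary f) x∈D fx≡false stepx≡true)
      where
        fx≡false : f x ≡ false
        fx≡false = ¬-not λ fx≡true → changed (trans (step-inflationary f x fx≡true) (sym fx≡true))
        stepx≡true : step r D f x ≡ true
        stepx≡true = ¬-not λ stepx≡false → changed (trans stepx≡false (sym fx≡false))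

    iter-suc-stable : ∀ f n → Stable (iter r n D f) → Stable (iter r (suc n) D f)
    iter-suc-stable f n st = Stable-resp (λ x → sym (trans (iter-suc f n x) (st x))) st

    iter-stable-or-large : ∀ f n → Stable (iter r n D f) ⊎ n ≤ count (iter r n D f) D
    iter-stable-or-large f zero = inj₂ z≤n
    iter-stable-or-large f (suc n) with iter-stable-or-large f n
    ... | inj₁ stable = inj₁ (iter-suc-stable f n stable)
    ... | inj₂ n≤ with stable-or-grows (iter r n D f)
    ...   | inj₁ stable = inj₁ (iter-suc-stable f n stable)
    ...   | inj₂ grows  =
      inj₂ (≤-trans (s≤s n≤) (≤-trans grows (≤-reflexive (count-cong (sym ∘ iter-suc f n) D))))

    -- A round that is not stable infects a new vertex of D, so after |D| rounds the process is stable.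
    iter-length-stable : ∀ f → Stable (iter r (length D) D f)
    iter-length-stable f with iter-stable-or-large f (length D)
    ... | inj₁ stable = stable
    ... | inj₂ N≤ with stable-or-grows (iter r (length D) D f)
    ... | inj₁ stable = stable
    ... | inj₂ grows = ⊥-elim (1+n≰n (≤-trans (≤-trans (s≤s N≤) grows) (count-≤-length _ D)))

    iter-least : ∀ {J f} → Closed r D J → (∀ x → f x ≡ true → J x ≡ true) →
                 ∀ n x → iter r n D f x ≡ true → J x ≡ true
    iter-least cl f⊆J zero = f⊆J
    iter-least {J} {f} cl f⊆J (suc n) = iter-least cl step⊆J n
      where
        step⊆J : ∀ x → step r D f x ≡ true → J x ≡ true
        step⊆J x e with f x in fx
        ... | true = f⊆J x fx
        ... | false with memb x D in mx
        ... | true  = cl x (memb⇒∈ D mx)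
                        (≤-trans (≤ᵇ⇒≤ r _ (Equivalence.from T-≡ e)) (count-mono neighbour⊆ D))
          where
            neighbour⊆ : ∀ y → adj x y ∧ f y ≡ true → adj x y ∧ J y ≡ true
            neighbour⊆ y h = cong₂ _∧_ (∧-conicalˡ _ _ h) (f⊆J y (∧-conicalʳ _ _ h))
        ... | false = contradiction e λ ()

  module _ {d : ℕ} (r : ℕ) (D S : List (Pt d)) where
    open Bootstrap r D

    closure-closed : Closed r D (closure r D S)
    closure-closed = stable⇒closed (iter-length-stable _)

    closure-init : ∀ {x} → x ∈ D → x ∈ S → closure r D S x ≡ true
    closure-init x∈D x∈S = iter-inflationary _ (length D) _ (cong₂ _∧_ (∈⇒memb x∈D) (∈⇒memb x∈S))

    closure-least : ∀ {J} → Closed r D J → (∀ {x} → x ∈ D → x ∈ S → J x ≡ true) →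
                    ∀ x → closure r D S x ≡ true → J x ≡ true
    closure-least cl init⊆J = iter-least cl (λ x e → init⊆J (memb⇒∈ D (∧-conicalˡ _ _ e))
                                                            (memb⇒∈ S (∧-conicalʳ _ _ e))) (length D)

  closure-mono-⊆ : ∀ {r} {D D′ S : List (Pt d)} → Unique D′ → D′ ⊆ D →
                   ∀ x → closure r D′ S x ≡ true → closure r D S x ≡ true
  closure-mono-⊆ {r = r} {D} {D′} {S} uD′ sub =
    closure-least r D′ S (Closed-⊆ uD′ sub (closure-closed r D S))
                         (λ x∈D′ x∈S → closure-init r D S (sub x∈D′) x∈S)

  module _ {A : Set} (f : A → Bool) where

    all-true⁻ : ∀ {xs} → all f xs ≡ true → ∀ {x} → x ∈ xs → f x ≡ true
    all-true⁻ {y ∷ xs} h (here refl) = ∧-conicalˡ _ _ h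
    all-true⁻ {y ∷ xs} h (there x∈) = all-true⁻ (∧-conicalʳ _ _ h) x∈

    all-true⁺ : ∀ xs → (∀ {x} → x ∈ xs → f x ≡ true) → all f xs ≡ true
    all-true⁺ [] h = refl
    all-true⁺ (x ∷ xs) h rewrite h (here refl) = all-true⁺ xs (h ∘ there)

    all-false⁻ : ∀ xs → all f xs ≡ false → ∃[ x ] x ∈ xs × f x ≡ false
    all-false⁻ (x ∷ xs) h with f x in fx
    ... | false = x , here refl , fx
    ... | true  = let (y , y∈ , fy) = all-false⁻ xs h in y , there y∈ , fy

    all-false⁺ : ∀ {xs x} → x ∈ xs → f x ≡ false → all f xs ≡ false
    all-false⁺ (here refl) fx rewrite fx = refl
    all-false⁺ {y ∷ _} (there x∈) fx with f y
    ... | true  = all-false⁺ x∈ fx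
    ... | false = refl

    any-false⁻ : ∀ {xs} → any f xs ≡ false → ∀ {x} → x ∈ xs → f x ≡ false
    any-false⁻ {y ∷ xs} h (here refl) = ∨-conicalˡ _ _ h
    any-false⁻ {y ∷ xs} h (there x∈) = any-false⁻ (∨-conicalʳ _ _ h) x∈

    any-false⁺ : ∀ xs → (∀ {x} → x ∈ xs → f x ≡ false) → any f xs ≡ false
    any-false⁺ [] h = refl
    any-false⁺ (x ∷ xs) h rewrite h (here refl) = any-false⁺ xs (h ∘ there)

    any-true⁺ : ∀ {xs x} → x ∈ xs → f x ≡ true → any f xs ≡ true
    any-true⁺ (here refl) fx rewrite fx = refl
    any-true⁺ {y ∷ _} (there x∈) fx with f y
    ... | true  = refl
    ... | false = any-true⁺ x∈ fx

  InCube : Vec ℕ d → ℕ → Pt d → Set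
  InCube a k x = ∀ i → lookup a i ≤ lookup x i × lookup x i < lookup a i + k

  ∈-range⁺ : ∀ {a k v} → a ≤ v → v < a + k → v ∈ range a k
  ∈-range⁺ {a} {k} a≤v v<a+k = subst (_∈ range a k) (m+[n∸m]≡n a≤v)
    (∈-map⁺ (a +_) (∈-upTo⁺ (+-cancelˡ-< a _ _ (subst (_< a + k) (sym (m+[n∸m]≡n a≤v)) v<a+k))))

  ∈-range⁻ : ∀ {a k v} → v ∈ range a k → a ≤ v × v < a + k
  ∈-range⁻ {a} v∈ with ∈-map⁻ (a +_) v∈
  ... | (u , u∈ , refl) = m≤m+n a u , +-monoʳ-< a (∈-upTo⁻ u∈)

  range-unique : ∀ a k → Unique (range a k)
  range-unique a k = Unique.map⁺ (+-cancelˡ-≡ a _ _) (Unique.upTo⁺ k)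

  cubePts-∷ : ∀ a (as : Vec ℕ d) k →
              cubePts (a ∷ as) k ≡ cartesianProductWith _∷_ (range a k) (cubePts as k)
  cubePts-∷ a as k = go (range a k)
    where
      go : ∀ xs → concatMap (λ x → map (x ∷_) (cubePts as k)) xs
                  ≡ cartesianProductWith _∷_ xs (cubePts as k)
      go []       = refl
      go (x ∷ xs) = cong (map (x ∷_) (cubePts as k) ++_) (go xs)

  ∈-cubePts⁺ : ∀ (a : Vec ℕ d) k {x} → InCube a k x → x ∈ cubePts a k
  ∈-cubePts⁺ [] k {[]} _ = here refl
  ∈-cubePts⁺ (a ∷ as) k {x ∷ xs} h rewrite cubePts-∷ a as k =
    ∈-cartesianProductWith⁺ _∷_ (∈-range⁺ (proj₁ (h zero)) (proj₂ (h zero))) (∈-cubePts⁺ as k (h ∘ suc))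

  ∈-cubePts⁻ : ∀ (a : Vec ℕ d) k {x} → x ∈ cubePts a k → InCube a k x
  ∈-cubePts⁻ (a ∷ as) k {x} x∈ rewrite cubePts-∷ a as k
    with ∈-cartesianProductWith⁻ _∷_ (range a k) (cubePts as k) x∈
  ... | (y , ys , y∈ , ys∈ , refl) = λ { zero → ∈-range⁻ y∈ ; (suc i) → ∈-cubePts⁻ as k ys∈ i }

  cubePts-unique : ∀ (a : Vec ℕ d) k → Unique (cubePts a k)
  cubePts-unique [] k = All.[] ∷ AllPairs.[]
  cubePts-unique (a ∷ as) k rewrite cubePts-∷ a as k =
    Unique.cartesianProductWith⁺ _∷_ ∷-injective (range-unique a k) (cubePts-unique as k)

  InBox : ℕ → Pt d → Set
  InBox n x = ∀ i → 1 ≤ lookup x i × lookup x i ≤ n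

  ∈-box⁺ : ∀ {n} {x : Pt d} → InBox n x → x ∈ cubePts (replicate d 1) n
  ∈-box⁺ {d} {n} {x} h = ∈-cubePts⁺ (replicate d 1) n λ i → subst (λ c → c ≤ lookup x i × lookup x i < c + n)
    (sym (lookup-replicate i 1)) (proj₁ (h i) , s≤s (proj₂ (h i)))

  ∈-box⁻ : ∀ {n} {x : Pt d} → x ∈ cubePts (replicate d 1) n → InBox n x
  ∈-box⁻ {d} {n} {x} x∈ i with ∈-cubePts⁻ (replicate d 1) n x∈ i
  ... | (lo , hi) rewrite lookup-replicate i 1 = lo , ≤-pred hi

  UnitMove : Pt d → Fin d → ℕ → Set
  UnitMove x i v = ∣ lookup x i - v ∣ ≡ 1

  UnitMove⇒≢ : ∀ {x : Pt d} {i v} → UnitMove x i v → v ≢ lookup x i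
  UnitMove⇒≢ {x = x} {i} h refl with () ← trans (sym h) (∣n-n∣≡0 (lookup x i))

  l1-self : ∀ (x : Pt d) → l1 x x ≡ 0
  l1-self []      = refl
  l1-self (a ∷ x) rewrite ∣n-n∣≡0 a = l1-self x

  l1-[]≔ : ∀ (x : Pt d) i v → l1 x (x [ i ]≔ v) ≡ ∣ lookup x i - v ∣
  l1-[]≔ (a ∷ x) zero    v rewrite l1-self x = +-identityʳ _
  l1-[]≔ (a ∷ x) (suc i) v rewrite ∣n-n∣≡0 a = l1-[]≔ x i v

  adj-[]≔ : ∀ {x : Pt d} {i v} → UnitMove x i v → adj x (x [ i ]≔ v) ≡ true
  adj-[]≔ {x = x} {i} {v} h rewrite l1-[]≔ x i v | h = refl

  []≔-injective : ∀ {A : Set} (x : Vec A d) {i j v w} → v ≢ lookup x i →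
                  x [ i ]≔ v ≡ x [ j ]≔ w → i ≡ j × v ≡ w
  []≔-injective x {i} {j} {v} {w} v≢xᵢ e with i Fin.≟ j
  ... | yes refl = refl , trans (sym (lookup∘update i x v)) (trans (cong (λ y → lookup y i) e) (lookup∘update i x w))
  ... | no i≢j   = contradiction (trans (sym (lookup∘update i x v))
                     (trans (cong (λ y → lookup y i) e) (lookup∘update′ i≢j x w))) v≢xᵢ

  lookup-ext : ∀ {A : Set} {n} (xs ys : Vec A n) → (∀ i → lookup xs i ≡ lookup ys i) → xs ≡ ys
  lookup-ext xs ys h = trans (sym (tabulate∘lookup xs)) (trans (tabulate-cong h) (tabulate∘lookup ys))

  Move : ℕ → Set
  Move d = Fin d × ℕ

  ValidMove : List (Pt d) → (Pt d → Bool) → Pt d → Fin d → ℕ → Set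
  ValidMove D J x i v = UnitMove x i v × x [ i ]≔ v ∈ D × J (x [ i ]≔ v) ≡ true

  closed-by-moves : ∀ {r} {D : List (Pt d)} {J} → Closed r D J → ∀ {x} → x ∈ D →
    (mv : Fin r → Move d) → (∀ {k l} → mv k ≡ mv l → k ≡ l) →
    (∀ k → ValidMove D J x (proj₁ (mv k)) (proj₂ (mv k))) → J x ≡ true
  closed-by-moves {d} {r} {D} {J} closed {x} x∈D mv mv-injective moves =
    closed x x∈D (subst (_≤ _) (length-tabulate nbr)
      (length≤count (Unique.tabulate⁺ nbr-injective) (λ y∈ → nbr-∈D (∈-tabulate⁻ y∈))
                      (λ y∈ → nbr-infected (∈-tabulate⁻ y∈))))
    where
      nbr : Fin r → Pt d
      nbr k = x [ proj₁ (mv k) ]≔ proj₂ (mv k)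
      nbr-injective : ∀ {k l} → nbr k ≡ nbr l → k ≡ l
      nbr-injective {k} {l} e
        with []≔-injective x {proj₁ (mv k)} {proj₁ (mv l)} (UnitMove⇒≢ {x = x} (proj₁ (moves k))) e
      ... | (i≡ , v≡) = mv-injective (cong₂ _,_ i≡ v≡)
      nbr-∈D : ∀ {y} → ∃[ k ] y ≡ nbr k → y ∈ D
      nbr-∈D (k , refl) = proj₁ (proj₂ (moves k))
      nbr-infected : ∀ {y} → ∃[ k ] y ≡ nbr k → adj x y ∧ J y ≡ true
      nbr-infected (k , refl) =
        cong₂ _∧_ (adj-[]≔ {x = x} {proj₁ (mv k)} {proj₂ (mv k)} (proj₁ (moves k))) (proj₂ (proj₂ (moves k)))

  closed-by-coordinate-moves : ∀ {D : List (Pt d)} {J} → Closed d D J → ∀ {x} → x ∈ D → (v : Fin d → ℕ) →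
    (∀ i → ValidMove D J x i (v i)) → J x ≡ true
  closed-by-coordinate-moves closed x∈D v = closed-by-moves closed x∈D (λ i → i , v i) (cong proj₁)

  closed-by-moves-except : ∀ {D : List (Pt d)} {J} → Closed d D J → ∀ {x} → x ∈ D →
    (j : Fin d) (w : Fin d → ℕ) → (∀ i → i ≢ j → ValidMove D J x i (w i)) →
    (δ : Fin d) (u : ℕ) → (δ ≢ j → u ≢ w δ) → ValidMove D J x δ u → J x ≡ true
  closed-by-moves-except {d} {D} {J} closed {x} x∈D j w others δ u u≢wδ special =
    closed-by-moves closed x∈D (λ i → move i (i Fin.≟ j))
      (λ {k} {l} → distinct (k Fin.≟ j) (l Fin.≟ j)) (λ i → valid (i Fin.≟ j))
    where
      move : ∀ i → Dec (i ≡ j) → Move d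
      move i (yes _) = δ , u
      move i (no _)  = i , w i
      valid : ∀ {i} (i≟j : Dec (i ≡ j)) → ValidMove D J x (proj₁ (move i i≟j)) (proj₂ (move i i≟j))
      valid (yes _)  = special
      valid (no i≢j) = others _ i≢j
      distinct : ∀ {k l} (k≟j : Dec (k ≡ j)) (l≟j : Dec (l ≡ j)) → move k k≟j ≡ move l l≟j → k ≡ l
      distinct (yes k≡j) (yes l≡j) _ = trans k≡j (sym l≡j)
      distinct (yes _) (no l≢j) e with cong proj₁ e | cong proj₂ e
      ... | refl | u≡wδ = contradiction u≡wδ (u≢wδ l≢j)
      distinct (no k≢j) (yes _) e with cong proj₁ e | cong proj₂ e
      ... | refl | wδ≡u = contradiction (sym wδ≡u) (u≢wδ k≢j)
      distinct (no _) (no _) e = cong proj₁ e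

  record InnerUninfected (r T : ℕ) (S : List (Pt d)) : Set where
    field
      point      : Pt d
      ∈box       : point ∈ cubePts (replicate d 1) T
      uninfected : closure r (cubePts (replicate d 1) T) S point ≡ false
      i j        : Fin d
      i≢j        : i ≢ j
      i-inner    : lookup point i ≢ 1 × lookup point i ≢ T
      j-inner    : lookup point j ≢ 1 × lookup point j ≢ T

  not-on-side⇒inner : ∀ {T} {x : Pt d} → onSide (replicate d 1) T x ≡ false →
                      ∀ i → ∃[ j ] j ≢ i × lookup x j ≢ 1 × lookup x j ≢ T
  not-on-side⇒inner {d} {T} {x} h i
    with all-false⁻ _ (allFin d) (any-false⁻ _ h (∈-allFin i))
  ... | (j , _ , e)
    with i Fin.≟ j | lookup x j ≟ lookup (replicate d 1) j | lookup x j ≟ (lookup (replicate d 1) j + T ∸ 1) | e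
  ... | no i≢j | no ≢1 | no ≢T | _ = j , i≢j ∘ sym , ≢1 ∘ ≡1 , ≢T ∘ ≡T
    where
      ≡1 : lookup x j ≡ 1 → lookup x j ≡ lookup (replicate d 1) j
      ≡1 e = trans e (sym (lookup-replicate j 1))
      ≡T : lookup x j ≡ T → lookup x j ≡ lookup (replicate d 1) j + T ∸ 1
      ≡T e rewrite lookup-replicate j 1 = e

  module _ {r T : ℕ} {S : List (Pt d)} where

    private
      a = replicate d 1
      C = cubePts a T

    not-good⇒inner-uninfected : ∀ {x} → x ∈ C → Fin d →
      not (interior a T x) ∨ closure r C S x ≡ false → InnerUninfected r T S
    not-good⇒inner-uninfected {x} x∈ z e = record
      { point = x ; ∈box = x∈ ; uninfected = ∨-conicalʳ (not (interior a T x)) (closure r C S x) e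
      ; i = i ; j = j ; i≢j = i≢j ; i-inner = i-inner ; j-inner = j-inner }
      where
        not-side : onSide a T x ≡ false
        not-side = not-true⇒false (∧-conicalʳ (memb x C) (not (onSide a T x))
                     (not-false⇒true (∨-conicalˡ (not (interior a T x)) (closure r C S x) e)))
        i = proj₁ (not-on-side⇒inner {T = T} {x} not-side z)
        i-inner = proj₂ (proj₂ (not-on-side⇒inner {T = T} {x} not-side z))
        j = proj₁ (not-on-side⇒inner {T = T} {x} not-side i)
        j-inner = proj₂ (proj₂ (not-on-side⇒inner {T = T} {x} not-side i))
        i≢j : i ≢ j
        i≢j = proj₁ (proj₂ (not-on-side⇒inner {T = T} {x} not-side i)) ∘ sym

    bad⇒inner-uninfected : Fin d → good r a T S ≡ false → InnerUninfected r T S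
    bad⇒inner-uninfected z bad =
      let (x , x∈ , e) = all-false⁻ (λ x → not (interior a T x) ∨ closure r C S x) C bad
      in not-good⇒inner-uninfected x∈ z e

  -- The product measure

  fromℕ : ℕ → ℚ
  fromℕ zero    = 0ℚ
  fromℕ (suc n) = 1ℚ ℚ.+ fromℕ n

  0≤1 : 0ℚ ℚ.≤ 1ℚ
  0≤1 = ℚ.*≤* (ℤ.+≤+ z≤n)

  fromℕ-nonNeg : ∀ n → 0ℚ ℚ.≤ fromℕ n
  fromℕ-nonNeg zero    = ℚ.≤-refl
  fromℕ-nonNeg (suc n) = ℚ.+-mono-≤ 0≤1 (fromℕ-nonNeg n)

  fromℕ-pos : ∀ n → 0ℚ ℚ.< fromℕ (suc n)
  fromℕ-pos n = ℚ.<-≤-trans (ℚ.*<* (ℤ.+<+ (s≤s z≤n))) (ℚ.+-monoʳ-≤ 1ℚ (fromℕ-nonNeg n))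

  fromℕ-mono : ∀ {a b} → a ≤ b → fromℕ a ℚ.≤ fromℕ b
  fromℕ-mono {zero} {b} _ = fromℕ-nonNeg b
  fromℕ-mono (s≤s a≤b)    = ℚ.+-monoʳ-≤ 1ℚ (fromℕ-mono a≤b)

  pow-nonNeg : ∀ {r} → 0ℚ ℚ.≤ r → ∀ n → 0ℚ ℚ.≤ pow r n
  pow-nonNeg 0≤r zero    = 0≤1
  pow-nonNeg {r} 0≤r (suc n) = ℚ.≤-trans (ℚ.≤-reflexive (sym (ℚ.*-zeroʳ r)))
    (ℚ.*-monoˡ-≤-nonNeg r {{ℚ.nonNegative 0≤r}} (pow-nonNeg 0≤r n))

  pow-antitone : ∀ {r} → 0ℚ ℚ.≤ r → r ℚ.≤ 1ℚ → ∀ {a b} → a ≤ b → pow r b ℚ.≤ pow r a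
  pow-antitone 0≤r r≤1 {zero} {zero} _ = ℚ.≤-refl
  pow-antitone {r} 0≤r r≤1 {zero} {suc b} _ = ℚ.≤-trans
    (ℚ.*-monoʳ-≤-nonNeg (pow r b) {{ℚ.nonNegative (pow-nonNeg 0≤r b)}} r≤1)
    (ℚ.≤-trans (ℚ.≤-reflexive (ℚ.*-identityˡ (pow r b))) (pow-antitone 0≤r r≤1 {zero} {b} z≤n))
  pow-antitone {r} 0≤r r≤1 (s≤s a≤b) =
    ℚ.*-monoˡ-≤-nonNeg r {{ℚ.nonNegative 0≤r}} (pow-antitone 0≤r r≤1 a≤b)

  sumℚ : List ℚ → ℚ
  sumℚ = foldr ℚ._+_ 0ℚ

  sum-++ : ∀ (xs ys : List ℚ) → sumℚ (xs ++ ys) ≡ sumℚ xs ℚ.+ sumℚ ys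
  sum-++ []       ys = sym (ℚ.+-identityˡ (sumℚ ys))
  sum-++ (x ∷ xs) ys rewrite sum-++ xs ys = sym (ℚ.+-assoc x (sumℚ xs) (sumℚ ys))

  module _ {A : Set} where

    sum-cong : ∀ {g h : A → ℚ} xs → (∀ {x} → x ∈ xs → g x ≡ h x) → sumℚ (map g xs) ≡ sumℚ (map h xs)
    sum-cong []       e = refl
    sum-cong (x ∷ xs) e = cong₂ ℚ._+_ (e (here refl)) (sum-cong xs (e ∘ there))

    sum-mono : ∀ {g h : A → ℚ} xs → (∀ {x} → x ∈ xs → g x ℚ.≤ h x) →
               sumℚ (map g xs) ℚ.≤ sumℚ (map h xs)
    sum-mono []       e = ℚ.≤-refl
    sum-mono (x ∷ xs) e = ℚ.+-mono-≤ (e (here refl)) (sum-mono xs (e ∘ there))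

    sum-*ˡ : ∀ c (g : A → ℚ) xs → sumℚ (map (λ x → c ℚ.* g x) xs) ≡ c ℚ.* sumℚ (map g xs)
    sum-*ˡ c g []       = sym (ℚ.*-zeroʳ c)
    sum-*ˡ c g (x ∷ xs) rewrite sum-*ˡ c g xs = sym (ℚ.*-distribˡ-+ c (g x) _)

    sum-+ : ∀ (g h : A → ℚ) xs → sumℚ (map (λ x → g x ℚ.+ h x) xs) ≡ sumℚ (map g xs) ℚ.+ sumℚ (map h xs)
    sum-+ g h []       = sym (ℚ.+-identityˡ 0ℚ)
    sum-+ g h (x ∷ xs) rewrite sum-+ g h xs = interchange (g x) (h x) (sumℚ (map g xs)) (sumℚ (map h xs))
      where open CommSemigroupProperties (CommutativeMonoid.commutativeSemigroup ℚ.+-0-commutativeMonoid)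

    sum-const : ∀ c (xs : List A) → sumℚ (map (λ _ → c) xs) ≡ fromℕ (length xs) ℚ.* c
    sum-const c []       = sym (ℚ.*-zeroˡ c)
    sum-const c (x ∷ xs) rewrite sum-const c xs =
      trans (cong (ℚ._+ (fromℕ (length xs) ℚ.* c)) (sym (ℚ.*-identityˡ c)))
            (sym (ℚ.*-distribʳ-+ c 1ℚ (fromℕ (length xs))))

  length-∈-subsets : ∀ {A : Set} (V : List A) {S} → S ∈ subsets V → length S ≤ length V
  length-∈-subsets [] (here refl) = z≤n
  length-∈-subsets (x ∷ V) S∈ with ∈-++⁻ (map (x ∷_) (subsets V)) S∈
  ... | inj₂ S∈′ = m≤n⇒m≤1+n (length-∈-subsets V S∈′)
  ... | inj₁ S∈′ with ∈-map⁻ (x ∷_) S∈′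
  ... | (S′ , S′∈ , refl) = s≤s (length-∈-subsets V S′∈)

  avoids : (Pt d → Bool) → List (Pt d) → Bool
  avoids F S = all (not ∘ F) S

  module Probability (p : ℚ) (0≤p : 0ℚ ℚ.≤ p) (p≤1 : p ℚ.≤ 1ℚ) where

    q : ℚ
    q = 1ℚ ℚ.- p

    0≤q : 0ℚ ℚ.≤ q
    0≤q = ℚ.≤-trans (ℚ.≤-reflexive (sym (ℚ.+-inverseʳ p))) (ℚ.+-monoˡ-≤ (ℚ.- p) p≤1)

    q≤1 : q ℚ.≤ 1ℚ
    q≤1 = ℚ.≤-trans (ℚ.+-monoʳ-≤ 1ℚ (ℚ.neg-antimono-≤ 0≤p)) (ℚ.≤-reflexive (ℚ.+-identityʳ 1ℚ))

    p+q≡1 : p ℚ.+ q ≡ 1ℚ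
    p+q≡1 = begin
      p ℚ.+ (1ℚ ℚ.- p)   ≡⟨ cong (p ℚ.+_) (ℚ.+-comm 1ℚ (ℚ.- p)) ⟩
      p ℚ.+ (ℚ.- p ℚ.+ 1ℚ) ≡⟨ ℚ.+-assoc p (ℚ.- p) 1ℚ ⟨
      (p ℚ.- p) ℚ.+ 1ℚ   ≡⟨ cong (ℚ._+ 1ℚ) (ℚ.+-inverseʳ p) ⟩
      0ℚ ℚ.+ 1ℚ          ≡⟨ ℚ.+-identityˡ 1ℚ ⟩
      1ℚ                 ∎
      where open ≡-Reasoning

    weight : List (Pt d) → List (Pt d) → ℚ
    weight V S = pow p (length S) ℚ.* pow q (length V ∸ length S)

    weight-nonNeg : ∀ (V S : List (Pt d)) → 0ℚ ℚ.≤ weight V S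
    weight-nonNeg V S = ℚ.≤-trans (ℚ.≤-reflexive (sym (ℚ.*-zeroʳ (pow p (length S)))))
      (ℚ.*-monoˡ-≤-nonNeg (pow p (length S)) {{ℚ.nonNegative (pow-nonNeg 0≤p (length S))}}
                          (pow-nonNeg 0≤q (length V ∸ length S)))

    term : List (Pt d) → (List (Pt d) → Bool) → List (Pt d) → ℚ
    term V ev S = if ev S then weight V S else 0ℚ

    prob-cong : ∀ (V : List (Pt d)) {ev ev′} → (∀ S → ev S ≡ ev′ S) → prob p V ev ≡ prob p V ev′
    prob-cong V h = sum-cong (subsets V) λ {S} _ → cong (λ b → if b then weight V S else 0ℚ) (h S)

    prob-false : ∀ (V : List (Pt d)) → prob p V (λ _ → false) ≡ 0ℚ
    prob-false V = begin
      sumℚ (map (λ _ → 0ℚ) (subsets V))         ≡⟨ sum-const 0ℚ (subsets V) ⟩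
      fromℕ (length (subsets V)) ℚ.* 0ℚ          ≡⟨ ℚ.*-zeroʳ (fromℕ (length (subsets V))) ⟩
      0ℚ                                        ∎
      where open ≡-Reasoning

    prob-mono : ∀ (V : List (Pt d)) {ev ev′} → (∀ S → S ∈ subsets V → ev S ≡ true → ev′ S ≡ true) →
                prob p V ev ℚ.≤ prob p V ev′
    prob-mono V {ev} {ev′} h = sum-mono (subsets V) λ {S} S∈ → term-mono S S∈
      where
        term-mono : ∀ S → S ∈ subsets V → term V ev S ℚ.≤ term V ev′ S
        term-mono S S∈ with ev S in e | ev′ S in e′
        ... | true  | true  = ℚ.≤-refl
        ... | false | true  = weight-nonNeg V S
        ... | false | false = ℚ.≤-refl
        ... | true  | false = contradiction (trans (sym (h S S∈ e)) e′) λ ()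

    prob-∨ : ∀ (V : List (Pt d)) ev ev′ → prob p V (λ S → ev S ∨ ev′ S) ℚ.≤ prob p V ev ℚ.+ prob p V ev′
    prob-∨ V ev ev′ = ℚ.≤-trans (sum-mono (subsets V) λ {S} _ → term-∨ S)
                                (ℚ.≤-reflexive (sum-+ (term V ev) (term V ev′) (subsets V)))
      where
        term-∨ : ∀ S → term V (λ S → ev S ∨ ev′ S) S ℚ.≤ term V ev S ℚ.+ term V ev′ S
        term-∨ S with ev S | ev′ S
        ... | true  | true  = ℚ.≤-trans (ℚ.≤-reflexive (sym (ℚ.+-identityʳ (weight V S))))
                                        (ℚ.+-monoʳ-≤ (weight V S) (weight-nonNeg V S))
        ... | true  | false = ℚ.≤-reflexive (sym (ℚ.+-identityʳ (weight V S)))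
        ... | false | true  = ℚ.≤-reflexive (sym (ℚ.+-identityˡ (weight V S)))
        ... | false | false = ℚ.≤-reflexive (sym (ℚ.+-identityˡ 0ℚ))

    prob-∷ : ∀ (x : Pt d) V ev → prob p (x ∷ V) ev ≡ p ℚ.* prob p V (ev ∘ (x ∷_)) ℚ.+ q ℚ.* prob p V ev
    prob-∷ x V ev = begin
      sumℚ (map (term (x ∷ V) ev) (map (x ∷_) (subsets V) ++ subsets V))
        ≡⟨ cong sumℚ (map-++ (term (x ∷ V) ev) (map (x ∷_) (subsets V)) (subsets V)) ⟩
      sumℚ (map (term (x ∷ V) ev) (map (x ∷_) (subsets V)) ++ map (term (x ∷ V) ev) (subsets V))
        ≡⟨ sum-++ (map (term (x ∷ V) ev) (map (x ∷_) (subsets V))) _ ⟩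
      sumℚ (map (term (x ∷ V) ev) (map (x ∷_) (subsets V))) ℚ.+ sumℚ (map (term (x ∷ V) ev) (subsets V))
        ≡⟨ cong₂ ℚ._+_ (cong sumℚ (sym (map-∘ (subsets V)))) refl ⟩
      sumℚ (map (term (x ∷ V) ev ∘ (x ∷_)) (subsets V)) ℚ.+ sumℚ (map (term (x ∷ V) ev) (subsets V))
        ≡⟨ cong₂ ℚ._+_ (trans (sum-cong (subsets V) λ {S} _ → with-x S) (sum-*ˡ p _ (subsets V)))
                       (trans (sum-cong (subsets V) without-x) (sum-*ˡ q _ (subsets V))) ⟩
      p ℚ.* prob p V (ev ∘ (x ∷_)) ℚ.+ q ℚ.* prob p V ev ∎
      where
        open ≡-Reasoning
        if-* : ∀ b c t → (if b then c ℚ.* t else 0ℚ) ≡ c ℚ.* (if b then t else 0ℚ)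
        if-* true  c t = refl
        if-* false c t = sym (ℚ.*-zeroʳ c)
        with-x : ∀ S → term (x ∷ V) ev (x ∷ S) ≡ p ℚ.* term V (ev ∘ (x ∷_)) S
        with-x S = trans (cong (λ w → if ev (x ∷ S) then w else 0ℚ) (ℚ.*-assoc p (pow p (length S)) _))
                         (if-* (ev (x ∷ S)) p _)
        without-x : ∀ {S} → S ∈ subsets V → term (x ∷ V) ev S ≡ q ℚ.* term V ev S
        without-x {S} S∈ = trans (cong (λ w → if ev S then w else 0ℚ) weight-∷) (if-* (ev S) q _)
          where
            P = pow p (length S)
            Q = pow q (length V ∸ length S)
            weight-∷ : weight (x ∷ V) S ≡ q ℚ.* weight V S
            weight-∷ rewrite +-∸-assoc 1 (length-∈-subsets V S∈) = begin
              P ℚ.* (q ℚ.* Q) ≡⟨ cong (P ℚ.*_) (ℚ.*-comm q Q) ⟩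
              P ℚ.* (Q ℚ.* q) ≡⟨ ℚ.*-assoc P Q q ⟨
              (P ℚ.* Q) ℚ.* q ≡⟨ ℚ.*-comm (P ℚ.* Q) q ⟩
              q ℚ.* (P ℚ.* Q) ∎

    prob-avoids : ∀ (F : Pt d → Bool) V → prob p V (avoids F) ≡ pow q (count F V)
    prob-avoids F [] = trans (ℚ.+-identityʳ _) (ℚ.*-identityˡ 1ℚ)
    prob-avoids F (x ∷ V) with F x in Fx
    ... | true = begin
      prob p (x ∷ V) (avoids F)                                       ≡⟨ prob-∷ x V (avoids F) ⟩
      p ℚ.* prob p V (avoids F ∘ (x ∷_)) ℚ.+ q ℚ.* prob p V (avoids F)
        ≡⟨ cong₂ (λ a b → p ℚ.* a ℚ.+ q ℚ.* b)
                 (trans (prob-cong V λ S → cong (λ b → not b ∧ avoids F S) Fx) (prob-false V))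
                 (prob-avoids F V) ⟩
      p ℚ.* 0ℚ ℚ.+ q ℚ.* pow q (count F V)
        ≡⟨ cong (ℚ._+ (q ℚ.* pow q (count F V))) (ℚ.*-zeroʳ p) ⟩
      0ℚ ℚ.+ q ℚ.* pow q (count F V)                                     ≡⟨ ℚ.+-identityˡ _ ⟩
      q ℚ.* pow q (count F V)                                           ∎
      where open ≡-Reasoning
    ... | false = begin
      prob p (x ∷ V) (avoids F)                                       ≡⟨ prob-∷ x V (avoids F) ⟩
      p ℚ.* prob p V (avoids F ∘ (x ∷_)) ℚ.+ q ℚ.* prob p V (avoids F)
        ≡⟨ cong (λ a → p ℚ.* a ℚ.+ q ℚ.* prob p V (avoids F))
                (prob-cong V λ S → cong (λ b → not b ∧ avoids F S) Fx) ⟩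
      p ℚ.* prob p V (avoids F) ℚ.+ q ℚ.* prob p V (avoids F)          ≡⟨ ℚ.*-distribʳ-+ _ p q ⟨
      (p ℚ.+ q) ℚ.* prob p V (avoids F)                                ≡⟨ cong (ℚ._* prob p V (avoids F)) p+q≡1 ⟩
      1ℚ ℚ.* prob p V (avoids F)                                       ≡⟨ ℚ.*-identityˡ _ ⟩
      prob p V (avoids F)                                             ≡⟨ prob-avoids F V ⟩
      pow q (count F V)                                               ∎
      where open ≡-Reasoning

    prob-any : ∀ {X : Set} V (ev : X → List (Pt d) → Bool) (fam : List X) →
      prob p V (λ S → any (λ F → ev F S) fam) ℚ.≤ sumℚ (map (λ F → prob p V (ev F)) fam)
    prob-any V ev []        = ℚ.≤-reflexive (prob-false V)
    prob-any V ev (F ∷ fam) = ℚ.≤-trans (prob-∨ V (ev F) (λ S → any (λ F′ → ev F′ S) fam))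
                                        (ℚ.+-monoʳ-≤ (prob p V (ev F)) (prob-any V ev fam))

    union-bound : ∀ {X : Set} (toSet : X → Pt d → Bool) V ev (fam : List X) k →
      (∀ S → S ∈ subsets V → ev S ≡ true →
         ∃[ F ] F ∈ fam × k ≤ count (toSet F) V × avoids (toSet F) S ≡ true) →
      prob p V ev ℚ.≤ fromℕ (length fam) ℚ.* pow q k
    union-bound toSet V ev fam k witness = begin
      prob p V ev
        ≤⟨ prob-mono V (λ S S∈ e → let (F , F∈ , large , avoid) = witness S S∈ e
                                   in any-true⁺ _ F∈ (cong₂ _∧_ (≤⇒≤ᵇ′ large) avoid)) ⟩
      prob p V (λ S → any (λ F → event F S) fam)
        ≤⟨ prob-any V event fam ⟩
      sumℚ (map (λ F → prob p V (event F)) fam)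
        ≤⟨ sum-mono fam (λ {F} _ → prob-event≤ F) ⟩
      sumℚ (map (λ _ → pow q k) fam)
        ≡⟨ sum-const (pow q k) fam ⟩
      fromℕ (length fam) ℚ.* pow q k ∎
      where
        open ℚ.≤-Reasoning
        event = λ F S → (k ≤ᵇ count (toSet F) V) ∧ avoids (toSet F) S
        prob-event≤ : ∀ F → prob p V (event F) ℚ.≤ pow q k
        prob-event≤ F with k ≤ᵇ count (toSet F) V in large
        ... | true  = ℚ.≤-trans (ℚ.≤-reflexive (prob-avoids (toSet F) V))
                                (pow-antitone 0≤q q≤1 (≤ᵇ⇒≤ k _ (Equivalence.from T-≡ large)))
        ... | false = ℚ.≤-trans (ℚ.≤-reflexive (prob-false V)) (pow-nonNeg 0≤q k)

  ∣n-1+n∣≡1 : ∀ n → ∣ n - suc n ∣ ≡ 1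
  ∣n-1+n∣≡1 zero    = refl
  ∣n-1+n∣≡1 (suc n) = ∣n-1+n∣≡1 n

  ∣1+n-n∣≡1 : ∀ n → ∣ suc n - n ∣ ≡ 1
  ∣1+n-n∣≡1 n = trans (∣-∣-comm (suc n) n) (∣n-1+n∣≡1 n)

  -- The coordinate values 1, m, m + 1 and 2m of the sides of the subcubes of [2m]^d.
  data Lvl : Set where
    bot mid₁ mid₂ top : Lvl

  value : ℕ → Lvl → ℕ
  value m bot  = 1
  value m mid₁ = m
  value m mid₂ = suc m
  value m top  = 2 * m

  isMid : Lvl → Bool
  isMid mid₁ = true
  isMid mid₂ = true
  isMid _    = false

  flipMid : Lvl → Lvl
  flipMid mid₁ = mid₂
  flipMid mid₂ = mid₁
  flipMid l    = l

  isMid-flipMid : ∀ l → isMid (flipMid l) ≡ isMid l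
  isMid-flipMid bot  = refl
  isMid-flipMid mid₁ = refl
  isMid-flipMid mid₂ = refl
  isMid-flipMid top  = refl

  flipMid-involutive : ∀ l → flipMid (flipMid l) ≡ l
  flipMid-involutive bot  = refl
  flipMid-involutive mid₁ = refl
  flipMid-involutive mid₂ = refl
  flipMid-involutive top  = refl

  mid-cases : ∀ {v w} → isMid v ≡ true → isMid w ≡ true → v ≡ w ⊎ v ≡ flipMid w
  mid-cases {mid₁} {mid₁} _ _ = inj₁ refl
  mid-cases {mid₁} {mid₂} _ _ = inj₂ refl
  mid-cases {mid₂} {mid₁} _ _ = inj₂ refl
  mid-cases {mid₂} {mid₂} _ _ = inj₁ refl

  flipMid-unitMove : ∀ m {l} → isMid l ≡ true → ∣ value m l - value m (flipMid l) ∣ ≡ 1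
  flipMid-unitMove m {mid₁} _ = ∣n-1+n∣≡1 m
  flipMid-unitMove m {mid₂} _ = ∣1+n-n∣≡1 m

  pt : ℕ → Vec Lvl d → Pt d
  pt m = Vec.map (value m)

  lookup-pt : ∀ m (l : Vec Lvl d) i → lookup (pt m l) i ≡ value m (lookup l i)
  lookup-pt m l i = lookup-map i (value m) l

  pt-[]≔ : ∀ m (l : Vec Lvl d) i v → pt m (l [ i ]≔ v) ≡ pt m l [ i ]≔ value m v
  pt-[]≔ m l i v = map-[]≔ (value m) l i

  isMid-[]≔ : ∀ (l : Vec Lvl d) {i v} → isMid v ≡ isMid (lookup l i) →
              ∀ r → isMid (lookup (l [ i ]≔ v) r) ≡ isMid (lookup l r)
  isMid-[]≔ l {i} {v} same r with r Fin.≟ i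
  ... | yes refl = trans (cong isMid (lookup∘update r l v)) same
  ... | no r≢i   = cong isMid (lookup∘update′ r≢i l v)

  mid-kept : ∀ (l : Vec Lvl d) {i v r} → isMid (lookup l i) ≡ false →
             isMid (lookup l r) ≡ true → isMid (lookup (l [ i ]≔ v) r) ≡ true
  mid-kept l {i} {v} {r} nonmid mid with r Fin.≟ i
  ... | yes refl = contradiction (trans (sym mid) nonmid) λ ()
  ... | no r≢i   = trans (cong isMid (lookup∘update′ r≢i l v)) mid

  flipAt : Vec Lvl d → Fin d → Vec Lvl d
  flipAt l i = l [ i ]≔ flipMid (lookup l i)

  isMid-flipAt : ∀ (l : Vec Lvl d) i r → isMid (lookup (flipAt l i) r) ≡ isMid (lookup l r)
  isMid-flipAt l i = isMid-[]≔ l (isMid-flipMid (lookup l i))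

  flipAt-involutive : ∀ (l : Vec Lvl d) i → flipAt (flipAt l i) i ≡ l
  flipAt-involutive l i = begin
    flipAt l i [ i ]≔ flipMid (lookup (flipAt l i) i)
      ≡⟨ cong (λ v → flipAt l i [ i ]≔ flipMid v) (lookup∘update i l _) ⟩
    flipAt l i [ i ]≔ flipMid (flipMid (lookup l i))   ≡⟨ []≔-idempotent l i ⟩
    l [ i ]≔ flipMid (flipMid (lookup l i))            ≡⟨ cong (l [ i ]≔_) (flipMid-involutive (lookup l i)) ⟩
    l [ i ]≔ lookup l i                                ≡⟨ []≔-lookup l i ⟩
    l                                                  ∎
    where open ≡-Reasoning

  midCount : Vec Lvl d → ℕ
  midCount {d} l = count (λ i → isMid (lookup l i)) (allFin d)

  midCount-≤ : ∀ (l : Vec Lvl d) → midCount l ≤ d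
  midCount-≤ {d} l = ≤-trans (count-≤-length _ (allFin d)) (≤-reflexive (length-tabulate {n = d} (λ i → i)))

  midCount-≥ : ∀ (l : Vec Lvl d) (is : List (Fin d)) → Unique is →
               (∀ {i} → i ∈ is → isMid (lookup l i) ≡ true) → length is ≤ midCount l
  midCount-≥ {d} l is u mids = length≤count u (λ {i} _ → ∈-allFin i) mids

  midCount-[]≔ : ∀ (l : Vec Lvl d) {i v} → isMid v ≡ isMid (lookup l i) → midCount (l [ i ]≔ v) ≡ midCount l
  midCount-[]≔ {d} l same = count-cong (isMid-[]≔ l same) (allFin d)

  midCount-flipAt : ∀ (l : Vec Lvl d) i → midCount (flipAt l i) ≡ midCount l
  midCount-flipAt l i = midCount-[]≔ l (isMid-flipMid (lookup l i))

  midCount-< : ∀ (l : Vec Lvl d) {i v} → isMid (lookup l i) ≡ false → isMid v ≡ true →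
               midCount l < midCount (l [ i ]≔ v)
  midCount-< {d} l {i} {v} nonmid mid =
    count-mono-< (λ r → mid-kept l nonmid) (∈-allFin i) nonmid (trans (cong isMid (lookup∘update i l v)) mid)

  record TwoMids (l : Vec Lvl d) : Set where
    constructor twoMids
    field
      {p q} : Fin d
      p≢q   : p ≢ q
      p-mid : isMid (lookup l p) ≡ true
      q-mid : isMid (lookup l q) ≡ true

  another-mid : ∀ {l : Vec Lvl d} → TwoMids l → ∀ i → ∃[ j ] i ≢ j × isMid (lookup l j) ≡ true
  another-mid (twoMids {p} {q} p≢q mp mq) i with i Fin.≟ p
  ... | yes refl = q , p≢q , mq
  ... | no i≢p   = p , i≢p , mp

  TwoMids-flipAt : ∀ {l : Vec Lvl d} i → TwoMids l → TwoMids (flipAt l i)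
  TwoMids-flipAt {l = l} i (twoMids {p} {q} p≢q mp mq) =
    twoMids p≢q (trans (isMid-flipAt l i p) mp) (trans (isMid-flipAt l i q) mq)

  TwoMids-[]≔ : ∀ {l : Vec Lvl d} {r v} → isMid (lookup l r) ≡ false → TwoMids l → TwoMids (l [ r ]≔ v)
  TwoMids-[]≔ {l = l} nonmid (twoMids p≢q mp mq) = twoMids p≢q (mid-kept l nonmid mp) (mid-kept l nonmid mq)

  neighbours : Lvl → List Lvl
  neighbours bot  = mid₁ ∷ []
  neighbours mid₁ = mid₂ ∷ bot ∷ []
  neighbours mid₂ = mid₁ ∷ top ∷ []
  neighbours top  = mid₂ ∷ []

  stepIn outward : Lvl → Lvl
  stepIn bot  = mid₁
  stepIn mid₁ = mid₂
  stepIn mid₂ = mid₁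
  stepIn top  = mid₂
  outward mid₁ = bot
  outward mid₂ = top
  outward l    = l

  stepIn∈neighbours : ∀ l → stepIn l ∈ neighbours l
  stepIn∈neighbours bot  = here refl
  stepIn∈neighbours mid₁ = here refl
  stepIn∈neighbours mid₂ = here refl
  stepIn∈neighbours top  = here refl

  stepIn-mid : ∀ l → isMid (stepIn l) ≡ true
  stepIn-mid bot  = refl
  stepIn-mid mid₁ = refl
  stepIn-mid mid₂ = refl
  stepIn-mid top  = refl

  nonmid-neighbours : ∀ {l c} → isMid l ≡ false → c ∈ neighbours l → c ≡ stepIn l
  nonmid-neighbours {bot} _ (here refl) = refl
  nonmid-neighbours {top} _ (here refl) = refl

  mid-neighbours : ∀ {l c} → isMid l ≡ true → c ∈ neighbours l → c ≡ flipMid l ⊎ c ≡ outward l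
  mid-neighbours {mid₁} _ (here refl)         = inj₁ refl
  mid-neighbours {mid₁} _ (there (here refl)) = inj₂ refl
  mid-neighbours {mid₂} _ (here refl)         = inj₁ refl
  mid-neighbours {mid₂} _ (there (here refl)) = inj₂ refl

  isMid-outward : ∀ {l} → isMid l ≡ true → isMid (outward l) ≡ false
  isMid-outward {mid₁} _ = refl
  isMid-outward {mid₂} _ = refl

  flipMid≢ : ∀ {l} → isMid l ≡ true → flipMid l ≢ l
  flipMid≢ {mid₁} _ ()
  flipMid≢ {mid₂} _ ()

  outward-flipMid≢ : ∀ {l} → isMid l ≡ true → outward (flipMid l) ≢ outward l
  outward-flipMid≢ {mid₁} _ ()
  outward-flipMid≢ {mid₂} _ ()

  mid≢nonmid : ∀ {l l′} → isMid l ≡ true → isMid l′ ≡ false → l ≢ l′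
  mid≢nonmid ml ml′ refl = contradiction (trans (sym ml) ml′) λ ()

  neighbours-unit : ∀ {a b} → b ∈ neighbours a → ∣ value 2 a - value 2 b ∣ ≡ 1
  neighbours-unit {bot}  (here refl)         = refl
  neighbours-unit {mid₁} (here refl)         = refl
  neighbours-unit {mid₁} (there (here refl)) = refl
  neighbours-unit {mid₂} (here refl)         = refl
  neighbours-unit {mid₂} (there (here refl)) = refl
  neighbours-unit {top}  (here refl)         = refl

  value₂-injective : ∀ {a b} → value 2 a ≡ value 2 b → a ≡ b
  value₂-injective {bot}  {bot}  _ = refl
  value₂-injective {mid₁} {mid₁} _ = refl
  value₂-injective {mid₂} {mid₂} _ = refl
  value₂-injective {top}  {top}  _ = refl
  value₂-injective {bot}  {mid₁} ()
  value₂-injective {bot}  {mid₂} ()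
  value₂-injective {bot}  {top}  ()
  value₂-injective {mid₁} {bot}  ()
  value₂-injective {mid₁} {mid₂} ()
  value₂-injective {mid₁} {top}  ()
  value₂-injective {mid₂} {bot}  ()
  value₂-injective {mid₂} {mid₁} ()
  value₂-injective {mid₂} {top}  ()
  value₂-injective {top}  {bot}  ()
  value₂-injective {top}  {mid₁} ()
  value₂-injective {top}  {mid₂} ()

  _≟ₗ_ : (l l′ : Lvl) → Dec (l ≡ l′)
  l ≟ₗ l′ = map′ value₂-injective (cong (value 2)) (value 2 l ≟ value 2 l′)

  neighbours-irreflexive : ∀ {a b} → b ∈ neighbours a → b ≢ a
  neighbours-irreflexive {a} b∈ refl with () ← trans (sym (neighbours-unit b∈)) (∣n-n∣≡0 (value 2 a))

  neighbours-unique : ∀ a → Unique (neighbours a)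
  neighbours-unique bot  = All.[] ∷ AllPairs.[]
  neighbours-unique mid₁ = ((λ ()) All.∷ All.[]) ∷ All.[] ∷ AllPairs.[]
  neighbours-unique mid₂ = ((λ ()) All.∷ All.[]) ∷ All.[] ∷ AllPairs.[]
  neighbours-unique top  = All.[] ∷ AllPairs.[]

  length-neighbours : ∀ a → length (neighbours a) ≡ suc (if isMid a then 1 else 0)
  length-neighbours bot  = refl
  length-neighbours mid₁ = refl
  length-neighbours mid₂ = refl
  length-neighbours top  = refl

  odd : Lvl → Bool
  odd bot  = true
  odd mid₁ = false
  odd mid₂ = true
  odd top  = false

  neighbours-odd : ∀ {a b} → b ∈ neighbours a → odd b ≡ not (odd a)
  neighbours-odd {bot}  (here refl)         = refl
  neighbours-odd {mid₁} (here refl)         = refl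
  neighbours-odd {mid₁} (there (here refl)) = refl
  neighbours-odd {mid₂} (here refl)         = refl
  neighbours-odd {mid₂} (there (here refl)) = refl
  neighbours-odd {top}  (here refl)         = refl

  nbrs : ∀ {n} → Vec Lvl n → List (Vec Lvl n)
  nbrs []      = []
  nbrs (a ∷ μ) = map (_∷ μ) (neighbours a) ++ map (a ∷_) (nbrs μ)

  ∈-nbrs⁻ : ∀ {n} {μ ν : Vec Lvl n} → ν ∈ nbrs μ →
            ∃[ r ] ∃[ c ] c ∈ neighbours (lookup μ r) × ν ≡ μ [ r ]≔ c
  ∈-nbrs⁻ {μ = a ∷ μ} ν∈ with ∈-++⁻ (map (_∷ μ) (neighbours a)) ν∈
  ... | inj₁ ν∈₁ with ∈-map⁻ (_∷ μ) ν∈₁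
  ...   | (c , c∈ , refl) = zero , c , c∈ , refl
  ∈-nbrs⁻ {μ = a ∷ μ} ν∈ | inj₂ ν∈₂ with ∈-map⁻ (a ∷_) ν∈₂
  ...   | (ν′ , ν′∈ , refl) with ∈-nbrs⁻ {μ = μ} ν′∈
  ...     | (r , c , c∈ , refl) = suc r , c , c∈ , refl

  ∈-nbrs⁺ : ∀ {n} {μ : Vec Lvl n} {r c} → c ∈ neighbours (lookup μ r) → μ [ r ]≔ c ∈ nbrs μ
  ∈-nbrs⁺ {μ = a ∷ μ} {zero}  c∈ = ∈-++⁺ˡ (∈-map⁺ (_∷ μ) c∈)
  ∈-nbrs⁺ {μ = a ∷ μ} {suc r} c∈ = ∈-++⁺ʳ (map (_∷ μ) (neighbours a)) (∈-map⁺ (a ∷_) (∈-nbrs⁺ c∈))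

  nbrs-irreflexive : ∀ {n} {μ ν : Vec Lvl n} → ν ∈ nbrs μ → ν ≢ μ
  nbrs-irreflexive {μ = μ} ν∈ ν≡μ with ∈-nbrs⁻ {μ = μ} ν∈
  ... | (r , c , c∈ , refl) =
    neighbours-irreflexive c∈ (trans (sym (lookup∘update r μ c)) (cong (λ ν → lookup ν r) ν≡μ))

  nbrs-unique : ∀ {n} (μ : Vec Lvl n) → Unique (nbrs μ)
  nbrs-unique []      = AllPairs.[]
  nbrs-unique (a ∷ μ) = Unique.++⁺ (Unique.map⁺ (proj₁ ∘ ∷-injective) (neighbours-unique a))
                                   (Unique.map⁺ (proj₂ ∘ ∷-injective) (nbrs-unique μ)) disjoint
    where
      disjoint : ∀ {ν} → ¬ (ν ∈ map (_∷ μ) (neighbours a) × ν ∈ map (a ∷_) (nbrs μ))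
      disjoint (ν∈₁ , ν∈₂) with ∈-map⁻ (_∷ μ) ν∈₁ | ∈-map⁻ (a ∷_) ν∈₂
      ... | (c , c∈ , refl) | (_ , _ , e) = neighbours-irreflexive c∈ (proj₁ (∷-injective e))

  count-tabulate : ∀ {A : Set} {n} (P : A → Bool) (f : Fin n → A) → count P (tabulate f) ≡ count (P ∘ f) (allFin n)
  count-tabulate {n = zero}  P f = refl
  count-tabulate {n = suc n} P f with P (f zero)
  ... | true  = cong suc (trans (count-tabulate P (f ∘ suc)) (sym (count-tabulate (P ∘ f) suc)))
  ... | false = trans (count-tabulate P (f ∘ suc)) (sym (count-tabulate (P ∘ f) suc))

  midCount-∷ : ∀ {n} a (μ : Vec Lvl n) → midCount (a ∷ μ) ≡ (if isMid a then 1 else 0) + midCount μ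
  midCount-∷ a μ with isMid a
  ... | true  = cong suc (count-tabulate (λ i → isMid (lookup (a ∷ μ) i)) suc)
  ... | false = count-tabulate (λ i → isMid (lookup (a ∷ μ) i)) suc

  length-nbrs : ∀ {n} (μ : Vec Lvl n) → length (nbrs μ) ≡ n + midCount μ
  length-nbrs []      = refl
  length-nbrs {suc n} (a ∷ μ) rewrite midCount-∷ a μ = begin
    length (map (_∷ μ) (neighbours a) ++ map (a ∷_) (nbrs μ))   ≡⟨ length-++ (map (_∷ μ) (neighbours a)) ⟩
    length (map (_∷ μ) (neighbours a)) + length (map (a ∷_) (nbrs μ))
      ≡⟨ cong₂ _+_ (trans (length-map _ (neighbours a)) (length-neighbours a))
                   (trans (length-map _ (nbrs μ)) (length-nbrs μ)) ⟩
    suc ((if isMid a then 1 else 0) + (n + midCount μ))        ≡⟨ cong suc (shuffle (if isMid a then 1 else 0)) ⟩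
    suc (n + ((if isMid a then 1 else 0) + midCount μ))        ∎
    where
      open ≡-Reasoning
      shuffle : ∀ c → c + (n + midCount μ) ≡ n + (c + midCount μ)
      shuffle c = trans (sym (+-assoc c n _)) (trans (cong (_+ midCount μ) (+-comm c n)) (+-assoc n c _))

  parity : ∀ {n} → Vec Lvl n → Bool
  parity []      = false
  parity (a ∷ μ) = odd a xor parity μ

  parity-nbrs : ∀ {n} {μ ν : Vec Lvl n} → ν ∈ nbrs μ → parity ν ≡ not (parity μ)
  parity-nbrs {μ = a ∷ μ} ν∈ with ∈-++⁻ (map (_∷ μ) (neighbours a)) ν∈
  ... | inj₁ ν∈₁ with ∈-map⁻ (_∷ μ) ν∈₁
  ...   | (c , c∈ , refl) rewrite neighbours-odd c∈ = sym (not-distribˡ-xor (odd a) (parity μ))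
  parity-nbrs {μ = a ∷ μ} ν∈ | inj₂ ν∈₂ with ∈-map⁻ (a ∷_) ν∈₂
  ...   | (ν′ , ν′∈ , refl) rewrite parity-nbrs {μ = μ} ν′∈ = sym (not-distribʳ-xor (odd a) (parity μ))

  cell : Lvl → Lvl → List (Lvl × Lvl)
  cell A B = (A , B) ∷ (outward A , B) ∷ (A , outward B) ∷ []

  block : Lvl → Lvl → List (Lvl × Lvl)
  block A B = cell A B ++ cell (flipMid A) B ++ cell A (flipMid B) ++ cell (flipMid A) (flipMid B)

  block-unique : ∀ {A B} → isMid A ≡ true → isMid B ≡ true → Unique (block A B)
  block-unique {mid₁} {mid₁} _ _ = from-yes (UniqueDec.unique? (Product.≡-dec _≟ₗ_ _≟ₗ_) (block mid₁ mid₁))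
  block-unique {mid₁} {mid₂} _ _ = from-yes (UniqueDec.unique? (Product.≡-dec _≟ₗ_ _≟ₗ_) (block mid₁ mid₂))
  block-unique {mid₂} {mid₁} _ _ = from-yes (UniqueDec.unique? (Product.≡-dec _≟ₗ_ _≟ₗ_) (block mid₂ mid₁))
  block-unique {mid₂} {mid₂} _ _ = from-yes (UniqueDec.unique? (Product.≡-dec _≟ₗ_ _≟ₗ_) (block mid₂ mid₂))

  count-block : ∀ (P : Lvl × Lvl → Bool) A B →
    count P (block A B) ≡ count P (cell A B) + count P (cell (flipMid A) B)
                            + count P (cell A (flipMid B)) + count P (cell (flipMid A) (flipMid B))
  count-block P A B = begin
    count P (cell A B ++ cell (flipMid A) B ++ cell A (flipMid B) ++ cell (flipMid A) (flipMid B))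
      ≡⟨ count-++ P (cell A B) (cell (flipMid A) B ++ cell A (flipMid B) ++ cell (flipMid A) (flipMid B)) ⟩
    c₀₀ + count P (cell (flipMid A) B ++ cell A (flipMid B) ++ cell (flipMid A) (flipMid B))
      ≡⟨ cong (c₀₀ +_) (count-++ P (cell (flipMid A) B) (cell A (flipMid B) ++ cell (flipMid A) (flipMid B))) ⟩
    c₀₀ + (c₁₀ + count P (cell A (flipMid B) ++ cell (flipMid A) (flipMid B)))
      ≡⟨ cong (λ c → c₀₀ + (c₁₀ + c)) (count-++ P (cell A (flipMid B)) (cell (flipMid A) (flipMid B))) ⟩
    c₀₀ + (c₁₀ + (c₀₁ + c₁₁))   ≡⟨ +-assoc c₀₀ c₁₀ (c₀₁ + c₁₁) ⟨
    c₀₀ + c₁₀ + (c₀₁ + c₁₁)     ≡⟨ +-assoc (c₀₀ + c₁₀) c₀₁ c₁₁ ⟨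
    c₀₀ + c₁₀ + c₀₁ + c₁₁       ∎
    where
      open ≡-Reasoning
      c₀₀ = count P (cell A B)
      c₁₀ = count P (cell (flipMid A) B)
      c₀₁ = count P (cell A (flipMid B))
      c₁₁ = count P (cell (flipMid A) (flipMid B))

  module Grid {d : ℕ} (m : ℕ) where

    D : List (Pt d)
    D = grid d m

    ∈D⁺ : ∀ {x} → InBox (2 * m) x → x ∈ D
    ∈D⁺ = ∈-box⁺

    ∈D⁻ : ∀ {x} → x ∈ D → InBox (2 * m) x
    ∈D⁻ = ∈-box⁻

    []≔-∈D : ∀ {x i v} → x ∈ D → 1 ≤ v → v ≤ 2 * m → x [ i ]≔ v ∈ D
    []≔-∈D {x} {i} {v} x∈D 1≤v v≤2m = ∈D⁺ λ r → in-range r (r Fin.≟ i)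
      where
        in-range : ∀ r → Dec (r ≡ i) → 1 ≤ lookup (x [ i ]≔ v) r × lookup (x [ i ]≔ v) r ≤ 2 * m
        in-range r (yes refl) rewrite lookup∘update r x v = 1≤v , v≤2m
        in-range r (no r≢i)   rewrite lookup∘update′ r≢i x v = ∈D⁻ x∈D r

    value-∈ : 1 ≤ m → ∀ l → 1 ≤ value m l × value m l ≤ 2 * m
    value-∈ 1≤m bot  = s≤s z≤n , ≤-trans 1≤m (m≤m+n m (m + 0))
    value-∈ 1≤m mid₁ = 1≤m , m≤m+n m (m + 0)
    value-∈ 1≤m mid₂ = s≤s z≤n , ≤-trans (≤-reflexive (+-comm 1 m)) (+-monoʳ-≤ m (≤-trans 1≤m (m≤m+n m 0)))
    value-∈ 1≤m top  = ≤-trans 1≤m (m≤m+n m (m + 0)) , ≤-refl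

    pt-∈D : 1 ≤ m → ∀ (l : Vec Lvl d) → pt m l ∈ D
    pt-∈D 1≤m l = ∈D⁺ λ i → subst (λ t → 1 ≤ t × t ≤ 2 * m) (sym (lookup-pt m l i)) (value-∈ 1≤m (lookup l i))

    module Infection (S : List (Pt d)) where

      I : Pt d → Bool
      I = closure d D S

      Uninfected : Pt d → Set
      Uninfected x = I x ≡ false

      I-closed : Closed d D I
      I-closed = closure-closed d D S

      uninfected-propagates : ∀ {x y} → (I y ≡ true → I x ≡ true) → Uninfected x → Uninfected y
      uninfected-propagates infects ux = ¬-not λ iy → contradiction (trans (sym (infects iy)) ux) λ ()

      infected-propagates : ∀ {x y} → (Uninfected y → Uninfected x) → I x ≡ true → I y ≡ true
      infected-propagates h ix = ¬-not λ uy → contradiction (trans (sym ix) (h uy)) λ ()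

      avoids-uninfected : S ⊆ D → (F : Pt d → Bool) → (∀ {y} → F y ≡ true → Uninfected y) →
                          avoids F S ≡ true
      avoids-uninfected S⊆D F uninfected = all-true⁺ (not ∘ F) S not-in-F
        where
          not-in-F : ∀ {y} → y ∈ S → not (F y) ≡ true
          not-in-F {y} y∈S with F y in Fy
          ... | false = refl
          ... | true  = contradiction (trans (sym (closure-init d D S (S⊆D y∈S) y∈S)) (uninfected Fy)) λ ()

  -- m ≥ 3: two uninfected parallel lines

  interval-spread : (P : ℕ → Set) {lo hi t₀ : ℕ} → lo ≤ t₀ → t₀ ≤ hi → P t₀ →
    (∀ {t} → lo ≤ t → t ≤ hi → P t → P (suc t)) →
    (∀ {t} → lo ≤ suc t → suc t ≤ hi → P (suc t) → P t) →
    ∀ {t} → lo ≤ suc t → t ≤ suc hi → P t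
  interval-spread P {lo} {hi} {t₀} lo≤t₀ t₀≤hi Pt₀ up down {t} lo≤1+t t≤1+hi with ≤-total t₀ t
  ... | inj₁ t₀≤t = climb t t₀≤t t≤1+hi
    where
      climb : ∀ t → t₀ ≤ t → t ≤ suc hi → P t
      climb zero    t₀≤0 _ = subst P (n≤0⇒n≡0 t₀≤0) Pt₀
      climb (suc t) t₀≤1+t 1+t≤1+hi with t₀ ≟ suc t
      ... | yes refl = Pt₀
      ... | no t₀≢1+t =
        up (≤-trans lo≤t₀ t₀≤t′) (≤-pred 1+t≤1+hi) (climb t t₀≤t′ (m≤n⇒m≤1+n (≤-pred 1+t≤1+hi)))
        where t₀≤t′ = ≤-pred (≤∧≢⇒< t₀≤1+t t₀≢1+t)
  ... | inj₂ t≤t₀ = descend (t₀ ∸ t) t (m+[n∸m]≡n t≤t₀) lo≤1+t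
    where
      descend : ∀ n t → t + n ≡ t₀ → lo ≤ suc t → P t
      descend zero    t e _ = subst P (trans (sym e) (+-identityʳ t)) Pt₀
      descend (suc n) t e lo≤1+t = down lo≤1+t 1+t≤hi (descend n (suc t) e′ (m≤n⇒m≤1+n lo≤1+t))
        where
          e′ : suc t + n ≡ t₀
          e′ = trans (sym (+-suc t n)) e
          1+t≤hi : suc t ≤ hi
          1+t≤hi = ≤-trans (m≤m+n (suc t) n) (≤-trans (≤-reflexive e′) t₀≤hi)

  module LargeSide {d : ℕ} (k : ℕ) where

    m : ℕ
    m = 3 + k

    open Grid {d} m

    m≤2m : m ≤ 2 * m
    m≤2m = m≤m+n m (m + 0)

    m+3≤2m : 3 + m ≤ 2 * m
    m+3≤2m = ≤-trans (≤-reflexive (+-comm 3 m)) (+-monoʳ-≤ m (s≤s (s≤s (s≤s z≤n))))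

    data NonExtreme (t : ℕ) : Set where
      lower : 2 ≤ t → t ≤ 2 + k → NonExtreme t
      upper : 2 + m ≤ t → t < 2 * m → NonExtreme t

    NonExtreme-∈ : ∀ {t} → NonExtreme t → 1 ≤ t × t ≤ 2 * m
    NonExtreme-∈ (lower 2≤t t≤) = ≤-trans (s≤s z≤n) 2≤t , ≤-trans t≤ (≤-trans (n≤1+n _) m≤2m)
    NonExtreme-∈ (upper 2≤t t<) = ≤-trans (s≤s z≤n) 2≤t , <⇒≤ t<

    corner : ℕ → ℕ
    corner t = if t ≤ᵇ m then 1 else suc m

    corner-cases : ∀ t → (corner t ≡ 1 × t ≤ m) ⊎ (corner t ≡ suc m × m < t)
    corner-cases t with t ≤ᵇ m in e
    ... | true  = inj₁ (refl , ≤ᵇ⇒≤ t m (Equivalence.from T-≡ e))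
    ... | false = inj₂ (refl , ≰⇒> λ t≤m → contradiction (trans (sym (≤⇒≤ᵇ′ t≤m)) e) λ ())

    ∈-corners : ∀ {n} (a : Vec ℕ n) → (∀ i → lookup a i ≡ 1 ⊎ lookup a i ≡ suc m) → a ∈ corners n m
    ∈-corners [] h = here refl
    ∈-corners {suc n} (x ∷ a) h with h zero
    ... | inj₁ refl = ∈-++⁺ˡ (∈-map⁺ (1 ∷_) (∈-corners a (h ∘ suc)))
    ... | inj₂ refl = ∈-++⁺ʳ (map (1 ∷_) (corners n m)) (∈-map⁺ (suc m ∷_) (∈-corners a (h ∘ suc)))

    ∷-∈-corners⁻ : ∀ {n x} {a : Vec ℕ n} → x ∷ a ∈ corners (suc n) m →
                   (x ≡ 1 ⊎ x ≡ suc m) × a ∈ corners n m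
    ∷-∈-corners⁻ {n} xa∈ with ∈-++⁻ (map (1 ∷_) (corners n m)) xa∈
    ... | inj₁ xa∈′ with ∈-map⁻ (1 ∷_) xa∈′
    ...   | (_ , a∈ , refl) = inj₁ refl , a∈
    ∷-∈-corners⁻ {n} xa∈ | inj₂ xa∈′ with ∈-map⁻ (suc m ∷_) xa∈′
    ...   | (_ , a∈ , refl) = inj₂ refl , a∈

    corners-values : ∀ {n} {a : Vec ℕ n} → a ∈ corners n m → ∀ i → lookup a i ≡ 1 ⊎ lookup a i ≡ suc m
    corners-values {a = x ∷ a} xa∈ zero    = proj₁ (∷-∈-corners⁻ xa∈)
    corners-values {a = x ∷ a} xa∈ (suc i) = corners-values (proj₂ (∷-∈-corners⁻ xa∈)) i

    subcube-⊆ : ∀ {a} → a ∈ corners d m → cubePts a m ⊆ D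
    subcube-⊆ {a} a∈ {y} y∈ = ∈D⁺ λ i → bounds (corners-values a∈ i) (∈-cubePts⁻ a m y∈ i)
      where
        bounds : ∀ {i} → lookup a i ≡ 1 ⊎ lookup a i ≡ suc m →
                 lookup a i ≤ lookup y i × lookup y i < lookup a i + m → 1 ≤ lookup y i × lookup y i ≤ 2 * m
        bounds (inj₁ e) (lo , hi) rewrite e = lo , ≤-trans (≤-pred hi) m≤2m
        bounds (inj₂ e) (lo , hi) rewrite e =
          ≤-trans (s≤s z≤n) lo , ≤-trans (≤-pred hi) (≤-reflexive (cong (m +_) (sym (+-identityʳ m))))

    atExtreme-false : ∀ a t → t ≢ a → t ≢ a + m ∸ 1 → atExtreme a m t ≡ false
    atExtreme-false a t t≢a t≢b with t ≟ a | t ≟ (a + m ∸ 1)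
    ... | no _     | no _     = refl
    ... | yes t≡a  | _        = contradiction t≡a t≢a
    ... | no _     | yes t≡b  = contradiction t≡b t≢b

    NonExtreme⇒¬atExtreme : ∀ {t} → NonExtreme t → atExtreme (corner t) m t ≡ false
    NonExtreme⇒¬atExtreme {t} ne with corner-cases t | ne
    ... | inj₁ (e , _) | lower 2≤t t≤ rewrite e =
      atExtreme-false 1 t (λ { refl → 1+n≰n 2≤t }) (λ { refl → 1+n≰n t≤ })
    ... | inj₂ (e , _) | upper 2≤t t< rewrite e =
      atExtreme-false (suc m) t (λ { refl → 1+n≰n 2≤t })
                      (λ t≡ → 1+n≰n (subst (_< 2 * m) (trans t≡ (cong (m +_) (sym (+-identityʳ m)))) t<))
    ... | inj₁ (_ , t≤m) | upper 2≤t _ = ⊥-elim (1+n≰n (≤-trans (n≤1+n _) (≤-trans 2≤t t≤m)))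
    ... | inj₂ (_ , m<t) | lower _ t≤ = ⊥-elim (1+n≰n (≤-trans m<t (≤-trans t≤ (n≤1+n _))))

    inner : Lvl → ℕ
    inner bot  = 2
    inner mid₁ = 2 + k
    inner mid₂ = 2 + m
    inner top  = pred (2 * m)

    inner-nonExtreme : ∀ l → NonExtreme (inner l)
    inner-nonExtreme bot  = lower ≤-refl (s≤s (s≤s z≤n))
    inner-nonExtreme mid₁ = lower (s≤s (s≤s z≤n)) ≤-refl
    inner-nonExtreme mid₂ = upper ≤-refl m+3≤2m
    inner-nonExtreme top  = upper (≤-pred m+3≤2m) ≤-refl

    inner-unitMove : ∀ l → ∣ value m l - inner l ∣ ≡ 1
    inner-unitMove bot  = refl
    inner-unitMove mid₁ = ∣1+n-n∣≡1 (2 + k)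
    inner-unitMove mid₂ = ∣n-1+n∣≡1 (suc m)
    inner-unitMove top  = ∣1+n-n∣≡1 (pred (2 * m))

    flipMid≢inner : ∀ {l} → isMid l ≡ true → value m (flipMid l) ≢ inner l
    flipMid≢inner {mid₁} _ e = m≢1+n+m k {1} (sym (suc-injective (suc-injective e)))
    flipMid≢inner {mid₂} _ e = m≢1+n+m m {1} e

    line : Vec Lvl d → Fin d → ℕ → Pt d
    line l j t = pt m l [ j ]≔ t

    line-∈D : ∀ l j {t} → 1 ≤ t → t ≤ 2 * m → line l j t ∈ D
    line-∈D l j 1≤t t≤2m = []≔-∈D (pt-∈D (s≤s z≤n) l) 1≤t t≤2m

    strip : Vec Lvl d → Fin d → Fin d → List (Pt d)
    strip l j i = map (line (l [ i ]≔ mid₁) j) (range 1 (2 * m)) ++ map (line (l [ i ]≔ mid₂) j) (range 1 (2 * m))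

    length-strip : ∀ l j i → length (strip l j i) ≡ 4 * m
    length-strip l j i = begin
      length (strip l j i)                      ≡⟨ length-++ (map (line (l [ i ]≔ mid₁) j) (range 1 (2 * m))) ⟩
      length (map _ (range 1 (2 * m))) + length (map _ (range 1 (2 * m)))
        ≡⟨ cong₂ _+_ (trans (length-map _ (range 1 (2 * m))) length-range)
                     (trans (length-map _ (range 1 (2 * m))) length-range) ⟩
      2 * m + 2 * m                             ≡⟨ *-distribʳ-+ m 2 2 ⟨
      4 * m                                     ∎
      where
        open ≡-Reasoning
        length-range : length (range 1 (2 * m)) ≡ 2 * m
        length-range = trans (length-map (1 +_) (upTo (2 * m))) (length-upTo (2 * m))

    ∈-strip⁻ : ∀ {l j i y} → y ∈ strip l j i →
               ∃[ v ] ∃[ t ] isMid v ≡ true × 1 ≤ t × t ≤ 2 * m × y ≡ line (l [ i ]≔ v) j t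
    ∈-strip⁻ {l} {j} {i} y∈ with ∈-++⁻ (map (line (l [ i ]≔ mid₁) j) (range 1 (2 * m))) y∈
    ... | inj₁ y∈₁ with ∈-map⁻ (line (l [ i ]≔ mid₁) j) y∈₁
    ...   | (t , t∈ , refl) = mid₁ , t , refl , proj₁ (∈-range⁻ t∈) , ≤-pred (proj₂ (∈-range⁻ t∈)) , refl
    ∈-strip⁻ {l} {j} {i} y∈ | inj₂ y∈₂ with ∈-map⁻ (line (l [ i ]≔ mid₂) j) y∈₂
    ...   | (t , t∈ , refl) = mid₂ , t , refl , proj₁ (∈-range⁻ t∈) , ≤-pred (proj₂ (∈-range⁻ t∈)) , refl

    strip-⊆ : ∀ l j i → strip l j i ⊆ D
    strip-⊆ l j i y∈ with ∈-strip⁻ y∈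
    ... | (v , t , _ , 1≤t , t≤2m , refl) = line-∈D (l [ i ]≔ v) j 1≤t t≤2m

    strip-unique : ∀ l j i → i ≢ j → Unique (strip l j i)
    strip-unique l j i i≢j = Unique.++⁺ (half mid₁) (half mid₂) disjoint
      where
        at-j : ∀ v t → lookup (line (l [ i ]≔ v) j t) j ≡ t
        at-j v t = lookup∘update j (pt m (l [ i ]≔ v)) t
        at-i : ∀ v t → lookup (line (l [ i ]≔ v) j t) i ≡ value m v
        at-i v t = trans (lookup∘update′ i≢j (pt m (l [ i ]≔ v)) t)
                         (trans (lookup-pt m (l [ i ]≔ v) i) (cong (value m) (lookup∘update i l v)))
        half : ∀ v → Unique (map (line (l [ i ]≔ v) j) (range 1 (2 * m)))
        half v = Unique.map⁺ (λ {t} {t′} e → trans (sym (at-j v t)) (trans (cong (λ y → lookup y j) e) (at-j v t′)))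
                             (range-unique 1 (2 * m))
        disjoint : ∀ {y} → ¬ (y ∈ map (line (l [ i ]≔ mid₁) j) (range 1 (2 * m)) ×
                              y ∈ map (line (l [ i ]≔ mid₂) j) (range 1 (2 * m)))
        disjoint (y∈₁ , y∈₂)
          with ∈-map⁻ (line (l [ i ]≔ mid₁) j) y∈₁ | ∈-map⁻ (line (l [ i ]≔ mid₂) j) y∈₂
        ... | (t , _ , refl) | (t′ , _ , e) =
          1+n≢n (sym (trans (sym (at-i mid₁ t)) (trans (cong (λ y → lookup y i) e) (at-i mid₂ t′))))

    inner-point : Vec Lvl d → Fin d → Pt d
    inner-point l r = line l r (inner (lookup l r))

    line-flipAt-same : ∀ l i t → line (flipAt l i) i t ≡ line l i t
    line-flipAt-same l i t = trans (cong (_[ i ]≔ t) (pt-[]≔ m l i _)) ([]≔-idempotent (pt m l) i)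

    choose-level : ∀ {t} → Dec (t ≤ 1) → Dec (t ≤ m) → Dec (suc t ≤ 2 * m) → Lvl
    choose-level (yes _) _       _       = bot
    choose-level (no _)  (yes _) _       = mid₁
    choose-level (no _)  (no _)  (yes _) = mid₂
    choose-level (no _)  (no _)  (no _)  = top

    -- Level values are kept; the other values of each half are rounded to the middle level of that half.
    round : ℕ → Lvl
    round t = choose-level (t ≤? 1) (t ≤? m) (suc t ≤? 2 * m)

    data Rounding (t : ℕ) : Lvl → Set where
      exact : ∀ {v} → value m v ≡ t → Rounding t v
      below : 2 ≤ t → t ≤ 2 + k → Rounding t mid₁
      above : 2 + m ≤ t → t < 2 * m → Rounding t mid₂

    rounding : ∀ {t} → 1 ≤ t → t ≤ 2 * m → Rounding t (round t)
    rounding {t} 1≤t t≤2m = go (t ≤? 1) (t ≤? m) (suc t ≤? 2 * m)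
      where
        go : ∀ a b c → Rounding t (choose-level a b c)
        go (yes t≤1) _ _ = exact (≤-antisym 1≤t t≤1)
        go (no t≰1) (yes t≤m) _ with t ≟ m
        ... | yes refl = exact refl
        ... | no t≢m   = below (≰⇒> t≰1) (≤-pred (≤∧≢⇒< t≤m t≢m))
        go (no _) (no t≰m) (yes t<2m) with t ≟ suc m
        ... | yes refl = exact refl
        ... | no t≢1+m = above (≤∧≢⇒< (≰⇒> t≰m) (t≢1+m ∘ sym)) t<2m
        go (no _) (no _) (no t≮2m) = exact (≤-antisym (≮⇒≥ t≮2m) t≤2m)

    rounding-mid : ∀ {t v} → Rounding t v → t ≢ 1 → t ≢ 2 * m → isMid v ≡ true
    rounding-mid (exact {bot} e) t≢1 _  = contradiction (sym e) t≢1
    rounding-mid (exact {mid₁} _) _ _   = refl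
    rounding-mid (exact {mid₂} _) _ _   = refl
    rounding-mid (exact {top} e) _ t≢2m = contradiction (sym e) t≢2m
    rounding-mid (below _ _) _ _        = refl
    rounding-mid (above _ _) _ _        = refl

    rounding-nonExtreme : ∀ {t v} → Rounding t v → value m v ≢ t → NonExtreme t
    rounding-nonExtreme (exact e)       inexact = contradiction e inexact
    rounding-nonExtreme (below 2≤t t≤)  _       = lower 2≤t t≤
    rounding-nonExtreme (above lo≤t t<) _       = upper lo≤t t<

    level-of : Pt d → Vec Lvl d
    level-of x = Vec.map round x

    rounding-at : ∀ {x} → x ∈ D → ∀ i → Rounding (lookup x i) (lookup (level-of x) i)
    rounding-at {x} x∈D i = subst (Rounding (lookup x i)) (sym (lookup-map i round x))
                                  (rounding (proj₁ (∈D⁻ x∈D i)) (proj₂ (∈D⁻ x∈D i)))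

    ownCorner : Pt d → Vec ℕ d
    ownCorner x = Vec.map corner x

    lookup-ownCorner : ∀ x r → lookup (ownCorner x) r ≡ corner (lookup x r)
    lookup-ownCorner x r = lookup-map r corner x

    ownCorner-∈ : ∀ {x} → x ∈ D → ownCorner x ∈ corners d m
    ownCorner-∈ {x} _ = ∈-corners (ownCorner x) λ r → Data.Sum.map proj₁ proj₁
      (subst (λ c → (c ≡ 1 × lookup x r ≤ m) ⊎ (c ≡ suc m × m < lookup x r)) (sym (lookup-ownCorner x r))
             (corner-cases (lookup x r)))

    ∈-ownSubcube : ∀ {x} → x ∈ D → x ∈ cubePts (ownCorner x) m
    ∈-ownSubcube {x} x∈D = ∈-cubePts⁺ (ownCorner x) m λ r →
      subst (λ c → c ≤ lookup x r × lookup x r < c + m) (sym (lookup-ownCorner x r))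
            (within (corner-cases (lookup x r)) (∈D⁻ x∈D r))
      where
        within : ∀ {t} → (corner t ≡ 1 × t ≤ m) ⊎ (corner t ≡ suc m × m < t) → 1 ≤ t × t ≤ 2 * m →
                 corner t ≤ t × t < corner t + m
        within (inj₁ (e , t≤m)) (1≤t , _) rewrite e = 1≤t , s≤s t≤m
        within (inj₂ (e , m<t)) (_ , t≤2m) rewrite e =
          m<t , s≤s (≤-trans t≤2m (≤-reflexive (cong (m +_) (+-identityʳ m))))

    nonExtreme-pair-interior : ∀ {x} → x ∈ D → ∀ {i j} → i ≢ j →
      NonExtreme (lookup x i) → NonExtreme (lookup x j) → interior (ownCorner x) m x ≡ true
    nonExtreme-pair-interior {x} x∈D {i} {j} i≢j nei nej =
      cong₂ (λ u v → u ∧ not v) (∈⇒memb (∈-ownSubcube x∈D)) not-side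
      where
        not-extreme : ∀ {r} → NonExtreme (lookup x r) → atExtreme (lookup (ownCorner x) r) m (lookup x r) ≡ false
        not-extreme {r} ne rewrite lookup-ownCorner x r = NonExtreme⇒¬atExtreme ne
        witness : ∀ i′ → Dec (i′ ≡ i) →
                  all (λ j′ → ⌊ i′ Fin.≟ j′ ⌋ ∨ atExtreme (lookup (ownCorner x) j′) m (lookup x j′)) (allFin d) ≡ false
        witness i′ (yes refl) =
          all-false⁺ _ (∈-allFin j) (cong₂ _∨_ (⌊⌋-false (i′ Fin.≟ j) i≢j) (not-extreme nej))
        witness i′ (no i′≢i)  =
          all-false⁺ _ (∈-allFin i) (cong₂ _∨_ (⌊⌋-false (i′ Fin.≟ i) i′≢i) (not-extreme nei))
        not-side : onSide (ownCorner x) m x ≡ false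
        not-side = any-false⁺ _ (allFin d) λ {i′} _ → witness i′ (i′ Fin.≟ i)

    module _ (S : List (Pt d)) (subcubes-good : all (λ a → good d a m S) (corners d m) ≡ true) where

      open Infection S

      nonExtreme-pair-infected : ∀ {x} → x ∈ D → ∀ {i j} → i ≢ j →
        NonExtreme (lookup x i) → NonExtreme (lookup x j) → I x ≡ true
      nonExtreme-pair-infected {x} x∈D i≢j nei nej =
        closure-mono-⊆ {S = S} (cubePts-unique (ownCorner x) m) (subcube-⊆ (ownCorner-∈ x∈D)) x infected
        where
          infected : closure d (cubePts (ownCorner x) m) S x ≡ true
          infected with all-true⁻ _ (all-true⁻ _ subcubes-good (ownCorner-∈ x∈D)) (∈-ownSubcube x∈D)
          ... | e rewrite nonExtreme-pair-interior x∈D i≢j nei nej = e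

      -- Every coordinate r ≠ j of a line point moved inward gives a point with two non-extreme
      -- coordinates; so a line point with one more infected neighbour is infected.
      inner-move : ∀ l j {t} → NonExtreme t → ∀ r → r ≢ j →
                    ValidMove D I (line l j t) r (inner (lookup l r))
      inner-move l j {t} ne r r≢j = unit , ∈D , nonExtreme-pair-infected ∈D r≢j ne-r ne-j
        where
          y = line l j t [ r ]≔ inner (lookup l r)
          unit : UnitMove (line l j t) r (inner (lookup l r))
          unit rewrite lookup∘update′ r≢j (pt m l) t | lookup-pt m l r = inner-unitMove (lookup l r)
          ∈D : y ∈ D
          ∈D = []≔-∈D (line-∈D l j (proj₁ (NonExtreme-∈ ne)) (proj₂ (NonExtreme-∈ ne)))
                      (proj₁ (NonExtreme-∈ (inner-nonExtreme (lookup l r))))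
                      (proj₂ (NonExtreme-∈ (inner-nonExtreme (lookup l r))))
          ne-r : NonExtreme (lookup y r)
          ne-r rewrite lookup∘update r (line l j t) (inner (lookup l r)) = inner-nonExtreme (lookup l r)
          ne-j : NonExtreme (lookup y j)
          ne-j rewrite lookup∘update′ (r≢j ∘ sym) (line l j t) (inner (lookup l r)) | lookup∘update j (pt m l) t = ne

      line-step : ∀ l j {t t′} → NonExtreme t → ∣ t - t′ ∣ ≡ 1 → 1 ≤ t′ → t′ ≤ 2 * m →
                  Uninfected (line l j t) → Uninfected (line l j t′)
      line-step l j {t} {t′} ne unit 1≤t′ t′≤2m = uninfected-propagates λ infected →
        closed-by-moves-except I-closed (line-∈D l j (proj₁ (NonExtreme-∈ ne)) (proj₂ (NonExtreme-∈ ne)))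
          j (inner ∘ lookup l) (inner-move l j ne) j t′ (λ j≢j → contradiction refl j≢j)
          ( subst (λ v → ∣ v - t′ ∣ ≡ 1) (sym (lookup∘update j (pt m l) t)) unit
          , subst (_∈ D) (sym ([]≔-idempotent (pt m l) j)) (line-∈D l j 1≤t′ t′≤2m)
          , subst (λ y → I y ≡ true) (sym ([]≔-idempotent (pt m l) j)) infected )

      line-flip : ∀ l j {t} i → NonExtreme t → i ≢ j → isMid (lookup l i) ≡ true →
                  Uninfected (line l j t) → Uninfected (line (flipAt l i) j t)
      line-flip l j {t} i ne i≢j mid = uninfected-propagates λ infected →
        closed-by-moves-except I-closed (line-∈D l j (proj₁ (NonExtreme-∈ ne)) (proj₂ (NonExtreme-∈ ne)))
          j (inner ∘ lookup l) (inner-move l j ne) i (value m (flipMid (lookup l i)))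
          (λ _ → flipMid≢inner mid)
          ( subst (λ v → ∣ v - value m (flipMid (lookup l i)) ∣ ≡ 1)
                  (sym (trans (lookup∘update′ i≢j (pt m l) t) (lookup-pt m l i))) (flipMid-unitMove m mid)
          , subst (_∈ D) (sym flipped) (line-∈D (flipAt l i) j (proj₁ (NonExtreme-∈ ne)) (proj₂ (NonExtreme-∈ ne)))
          , subst (λ y → I y ≡ true) (sym flipped) infected )
        where
          flipped : line l j t [ i ]≔ value m (flipMid (lookup l i)) ≡ line (flipAt l i) j t
          flipped = begin
            pt m l [ j ]≔ t [ i ]≔ value m (flipMid (lookup l i))   ≡⟨ []≔-commutes (pt m l) j i (i≢j ∘ sym) ⟩
            pt m l [ i ]≔ value m (flipMid (lookup l i)) [ j ]≔ t   ≡⟨ cong (_[ j ]≔ t) (pt-[]≔ m l i _) ⟨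
            pt m (flipAt l i) [ j ]≔ t                              ∎
            where open ≡-Reasoning

      lower-half-uninfected : ∀ {l j t₀} → 2 ≤ t₀ → t₀ ≤ 2 + k → Uninfected (line l j t₀) →
                              ∀ {t} → 1 ≤ t → t ≤ m → Uninfected (line l j t)
      lower-half-uninfected {l} {j} 2≤t₀ t₀≤ u₀ 1≤t t≤m =
        interval-spread (Uninfected ∘ line l j) 2≤t₀ t₀≤ u₀
          (λ {t} 2≤t t≤ → line-step l j (lower 2≤t t≤) (∣n-1+n∣≡1 t) (s≤s z≤n) (≤-trans (s≤s t≤) m≤2m))
          (λ {t} 2≤1+t 1+t≤ → line-step l j (lower 2≤1+t 1+t≤) (∣1+n-n∣≡1 t) (≤-pred 2≤1+t)
                                        (≤-trans (n≤1+n t) (≤-trans (m≤n⇒m≤1+n 1+t≤) m≤2m)))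
          (s≤s 1≤t) t≤m

      upper-half-uninfected : ∀ {l j t₀} → 2 + m ≤ t₀ → t₀ < 2 * m → Uninfected (line l j t₀) →
                              ∀ {t} → suc m ≤ t → t ≤ 2 * m → Uninfected (line l j t)
      upper-half-uninfected {l} {j} 2+m≤t₀ t₀< u₀ m<t t≤2m =
        interval-spread (Uninfected ∘ line l j) 2+m≤t₀ (≤-pred t₀<) u₀
          (λ {t} lo≤t t≤ → line-step l j (upper lo≤t (s≤s t≤)) (∣n-1+n∣≡1 t) (s≤s z≤n) (s≤s t≤))
          (λ {t} lo≤1+t 1+t≤ → line-step l j (upper lo≤1+t (s≤s 1+t≤)) (∣1+n-n∣≡1 t)
                                          (≤-trans (s≤s z≤n) (≤-pred lo≤1+t)) (≤-trans (n≤1+n t) (≤-trans 1+t≤ pred[n]≤n)))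
          (s≤s m<t) t≤2m

      line-uninfected : ∀ {l j tₗ tᵤ} → 2 ≤ tₗ → tₗ ≤ 2 + k → 2 + m ≤ tᵤ → tᵤ < 2 * m →
        Uninfected (line l j tₗ) → Uninfected (line l j tᵤ) →
        ∀ {t} → 1 ≤ t → t ≤ 2 * m → Uninfected (line l j t)
      line-uninfected 2≤tₗ tₗ≤ lo≤tᵤ tᵤ< uₗ uᵤ {t} 1≤t t≤2m with t ≤? m
      ... | yes t≤m = lower-half-uninfected 2≤tₗ tₗ≤ uₗ 1≤t t≤m
      ... | no  t≰m = upper-half-uninfected lo≤tᵤ tᵤ< uᵤ (≰⇒> t≰m) t≤2m

      record UninfectedStrip : Set where
        field
          lvl        : Vec Lvl d
          dir across : Fin d
          across≢dir : across ≢ dir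
          uninfected : ∀ {y} → y ∈ strip lvl dir across → Uninfected y

      make-strip : ∀ l j i → i ≢ j → isMid (lookup l i) ≡ true → ∀ {tₗ tᵤ} → 2 ≤ tₗ → tₗ ≤ 2 + k →
        2 + m ≤ tᵤ → tᵤ < 2 * m → Uninfected (line l j tₗ) → Uninfected (line l j tᵤ) → UninfectedStrip
      make-strip l j i i≢j mid 2≤tₗ tₗ≤ lo≤tᵤ tᵤ< uₗ uᵤ = record
        { lvl = l ; dir = j ; across = i ; across≢dir = i≢j ; uninfected = uninfected }
        where
          flipped : ∀ {t} → 1 ≤ t → t ≤ 2 * m → Uninfected (line (flipAt l i) j t)
          flipped = line-uninfected 2≤tₗ tₗ≤ lo≤tᵤ tᵤ<
                      (line-flip l j i (lower 2≤tₗ tₗ≤) i≢j mid uₗ) (line-flip l j i (upper lo≤tᵤ tᵤ<) i≢j mid uᵤ)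
          uninfected : ∀ {y} → y ∈ strip l j i → Uninfected y
          uninfected y∈ with ∈-strip⁻ y∈
          ... | (v , t , v-mid , 1≤t , t≤2m , refl) with mid-cases v-mid mid
          ...   | inj₁ refl = subst (λ l′ → Uninfected (line l′ j t)) (sym ([]≔-lookup l i))
                                (line-uninfected 2≤tₗ tₗ≤ lo≤tᵤ tᵤ< uₗ uᵤ 1≤t t≤2m)
          ...   | inj₂ refl = flipped 1≤t t≤2m

      -- Flipping a mid coordinate does not change which other coordinates are settled (line-flip).
      settled : Vec Lvl d → Fin d → Bool
      settled l i = isMid (lookup l i) ∧ I (inner-point l i)

      settledCount : Vec Lvl d → ℕ
      settledCount l = count (settled l) (allFin d)

      settledCount-≤ : ∀ l → settledCount l ≤ midCount l
      settledCount-≤ l = count-mono (λ i → ∧-conicalˡ (isMid (lookup l i)) _) (allFin d)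

      data Progress (l : Vec Lvl d) : Set where
        found  : UninfectedStrip → Progress l
        raise  : ∀ {l′} → midCount l < midCount l′ → TwoMids l′ → Uninfected (pt m l′) → Progress l
        settle : ∀ {l′} → midCount l′ ≡ midCount l → settledCount l < settledCount l′ →
                 TwoMids l′ → Uninfected (pt m l′) → Progress l

      raise-from : ∀ {l r} → TwoMids l → isMid (lookup l r) ≡ false → Uninfected (inner-point l r) → Progress l
      raise-from {l} {r} two nonmid u with lookup l r in lr
      ... | bot = raise (midCount-< l (trans (cong isMid lr) refl) refl)
                        (TwoMids-[]≔ {l = l} {r} {mid₁} (trans (cong isMid lr) refl) two)
                        (subst Uninfected (sym (pt-[]≔ m l r mid₁))
                               (lower-half-uninfected ≤-refl (s≤s (s≤s z≤n)) u (s≤s z≤n) ≤-refl))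
      ... | top = raise (midCount-< l (trans (cong isMid lr) refl) refl)
                        (TwoMids-[]≔ {l = l} {r} {mid₂} (trans (cong isMid lr) refl) two)
                        (subst Uninfected (sym (pt-[]≔ m l r mid₂))
                               (upper-half-uninfected (≤-pred m+3≤2m) ≤-refl u ≤-refl
                                                      (≤-trans (n≤1+n _) (≤-trans (n≤1+n _) m+3≤2m))))

      strip-from-flip-pair : ∀ l i → isMid (lookup l i) ≡ true → ∀ {j} → i ≢ j → isMid (lookup l j) ≡ true →
        Uninfected (line l i (inner (lookup l i))) → Uninfected (line l i (inner (flipMid (lookup l i)))) →
        UninfectedStrip
      strip-from-flip-pair l i mid {j} i≢j mid-j u u′ with lookup l i
      ... | mid₁ = make-strip l i j (i≢j ∘ sym) mid-j (s≤s (s≤s z≤n)) ≤-refl ≤-refl m+3≤2m u u′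
      ... | mid₂ = make-strip l i j (i≢j ∘ sym) mid-j (s≤s (s≤s z≤n)) ≤-refl ≤-refl m+3≤2m u′ u

      infected-if-stuck : ∀ l →
        (∀ r → isMid (lookup l r) ≡ false → I (inner-point l r) ≡ true) →
        (∀ i → isMid (lookup l i) ≡ true → I (inner-point l i) ≡ false → I (pt m (flipAt l i)) ≡ true) →
        I (pt m l) ≡ true
      infected-if-stuck l outer-done flips =
        closed-by-coordinate-moves I-closed (pt-∈D (s≤s z≤n) l)
          (λ r → if I (inner-point l r) then inner (lookup l r) else value m (flipMid (lookup l r))) move
        where
          move : ∀ r → ValidMove D I (pt m l) r
                         (if I (inner-point l r) then inner (lookup l r) else value m (flipMid (lookup l r)))
          move r with I (inner-point l r) in e
          ... | true = subst (λ v → ∣ v - inner (lookup l r) ∣ ≡ 1) (sym (lookup-pt m l r)) (inner-unitMove (lookup l r))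
                     , line-∈D l r (proj₁ (NonExtreme-∈ (inner-nonExtreme (lookup l r))))
                                   (proj₂ (NonExtreme-∈ (inner-nonExtreme (lookup l r))))
                     , e
          ... | false with isMid (lookup l r) in mid
          ...   | false = contradiction (trans (sym (outer-done r mid)) e) λ ()
          ...   | true  = subst (λ v → ∣ v - value m (flipMid (lookup l r)) ∣ ≡ 1) (sym (lookup-pt m l r))
                                  (flipMid-unitMove m mid)
                        , subst (_∈ D) (pt-[]≔ m l r _) (pt-∈D (s≤s z≤n) (flipAt l r))
                        , subst (λ y → I y ≡ true) (pt-[]≔ m l r _) (flips r mid e)

      settled-flipAt : ∀ l i → isMid (lookup l i) ≡ true → I (inner-point l i) ≡ false →
                       ∀ r → settled l r ≡ true → settled (flipAt l i) r ≡ true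
      settled-flipAt l i mid ui r e with r Fin.≟ i
      ... | yes refl = contradiction (trans (sym e) (trans (cong (isMid (lookup l r) ∧_) ui) (∧-zeroʳ _))) λ ()
      ... | no r≢i = cong₂ _∧_ (trans (isMid-flipAt l i r) (∧-conicalˡ _ _ e))
                               (subst (λ y → I y ≡ true) (sym same) (infected-propagates back (∧-conicalʳ _ _ e)))
        where
          t = inner (lookup l r)
          same : inner-point (flipAt l i) r ≡ line (flipAt l i) r t
          same = cong (λ v → line (flipAt l i) r (inner v)) (lookup∘update′ r≢i l _)
          back : Uninfected (line (flipAt l i) r t) → Uninfected (line l r t)
          back u = subst (λ l′ → Uninfected (line l′ r t)) (flipAt-involutive l i)
                     (line-flip (flipAt l i) r i (inner-nonExtreme (lookup l r)) (r≢i ∘ sym)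
                                (trans (isMid-flipAt l i i) mid) u)

      progress : ∀ {l} → TwoMids l → Uninfected (pt m l) → Progress l
      progress {l} two u
        with Fin.any? (λ r → (isMid (lookup l r) ≟ᵇ false) ×-dec (I (inner-point l r) ≟ᵇ false))
      ... | yes (r , nonmid , ur) = raise-from two nonmid ur
      ... | no no-raise
        with Fin.any? (λ i → (isMid (lookup l i) ≟ᵇ true) ×-dec (I (inner-point l i) ≟ᵇ false)
                               ×-dec (I (pt m (flipAt l i)) ≟ᵇ false))
      ... | no stuck = contradiction (trans (sym (infected-if-stuck l outer-done flips)) u) λ ()
        where
          outer-done : ∀ r → isMid (lookup l r) ≡ false → I (inner-point l r) ≡ true
          outer-done r nonmid = ¬-not λ ur → no-raise (r , nonmid , ur)
          flips : ∀ i → isMid (lookup l i) ≡ true → I (inner-point l i) ≡ false → I (pt m (flipAt l i)) ≡ true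
          flips i mid ui = ¬-not λ uf → stuck (i , mid , ui , uf)
      ... | yes (i , mid , ui , uflip) with I (inner-point (flipAt l i) i) in e
      ...   | false = found (strip-from-flip-pair l i mid i≢j mid-j ui
                               (subst Uninfected (trans same (line-flipAt-same l i _)) e))
        where
          j = proj₁ (another-mid two i)
          i≢j = proj₁ (proj₂ (another-mid two i))
          mid-j = proj₂ (proj₂ (another-mid two i))
          same : inner-point (flipAt l i) i ≡ line (flipAt l i) i (inner (flipMid (lookup l i)))
          same = cong (λ v → line (flipAt l i) i (inner v)) (lookup∘update i l _)
      ...   | true = settle (midCount-flipAt l i)
                            (count-mono-< (settled-flipAt l i mid ui) (∈-allFin i)
                                          (trans (cong (isMid (lookup l i) ∧_) ui) (∧-zeroʳ _))
                                          (cong₂ _∧_ (trans (isMid-flipAt l i i) mid) e))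
                            (TwoMids-flipAt i two) uflip

      strip-from : ∀ a b {l} → d ≤ midCount l + a → midCount l ≤ settledCount l + b → Progress l → UninfectedStrip
      strip-from a       b       ha hb (found s) = s
      strip-from zero    b {l} ha hb (raise {l′} lt _ _) =
        ⊥-elim (1+n≰n (≤-trans lt (≤-trans (midCount-≤ l′) (≤-trans ha (≤-reflexive (+-identityʳ _))))))
      strip-from (suc a) b {l} ha hb (raise {l′} lt two u) =
        strip-from a (midCount l′) (≤-trans ha (≤-trans (≤-reflexive (+-suc (midCount l) a)) (+-monoˡ-≤ a lt)))
                   (m≤n+m _ _) (progress two u)
      strip-from a zero {l} ha hb (settle {l′} same lt _ _) =
        ⊥-elim (1+n≰n (≤-trans lt (≤-trans (settledCount-≤ l′)
                        (≤-trans (≤-reflexive same) (≤-trans hb (≤-reflexive (+-identityʳ _)))))))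
      strip-from a (suc b) {l} ha hb (settle {l′} same lt two u) =
        strip-from a b (subst (λ c → d ≤ c + a) (sym same) ha)
                   (≤-trans (≤-reflexive same)
                            (≤-trans hb (≤-trans (≤-reflexive (+-suc (settledCount l) b)) (+-monoˡ-≤ b lt))))
                   (progress two u)

      rounding-spread : ∀ {l j t v} → Rounding t v → value m v ≢ t →
                        Uninfected (line l j t) → Uninfected (line l j (value m v))
      rounding-spread (exact e)       inexact _ = contradiction e inexact
      rounding-spread (below 2≤t t≤)  _       u = lower-half-uninfected 2≤t t≤ u (s≤s z≤n) ≤-refl
      rounding-spread (above lo≤t t<) _       u =
        upper-half-uninfected lo≤t t< u ≤-refl (≤-trans (n≤1+n _) (≤-trans (n≤1+n _) m+3≤2m))

      level-of-uninfected : ∀ {x} → x ∈ D → Uninfected x → Uninfected (pt m (level-of x))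
      level-of-uninfected {x} x∈D u with Fin.all? (λ i → value m (lookup (level-of x) i) ≟ lookup x i)
      ... | yes all-exact = subst Uninfected (lookup-ext x (pt m (level-of x))
                              λ i → sym (trans (lookup-pt m (level-of x) i) (all-exact i))) u
      ... | no ¬all-exact with Fin.¬∀⟶∃¬ d _ (λ i → value m (lookup (level-of x) i) ≟ lookup x i) ¬all-exact
      ... | (j , inexact-j) =
        subst Uninfected (trans (cong (pt m lv [ j ]≔_) (sym (lookup-pt m lv j))) ([]≔-lookup (pt m lv) j))
              (rounding-spread (rounding-at x∈D j) inexact-j (subst Uninfected x≡line u))
        where
          lv = level-of x
          exact-elsewhere : ∀ i → i ≢ j → value m (lookup lv i) ≡ lookup x i
          exact-elsewhere i i≢j = decidable-stable (value m (lookup lv i) ≟ lookup x i) λ inexact-i →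
            contradiction (trans (sym (nonExtreme-pair-infected x∈D i≢j
                                         (rounding-nonExtreme (rounding-at x∈D i) inexact-i)
                                         (rounding-nonExtreme (rounding-at x∈D j) inexact-j))) u) λ ()
          x≡line : x ≡ line lv j (lookup x j)
          x≡line = lookup-ext x (line lv j (lookup x j)) λ i → coordinate i (i Fin.≟ j)
            where
              coordinate : ∀ i → Dec (i ≡ j) → lookup x i ≡ lookup (line lv j (lookup x j)) i
              coordinate i (yes refl) = sym (lookup∘update i (pt m lv) (lookup x i))
              coordinate i (no i≢j)   = sym (trans (lookup∘update′ i≢j (pt m lv) (lookup x j))
                                                   (trans (lookup-pt m lv i) (exact-elsewhere i i≢j)))

      bad⇒strip : Fin d → good d (replicate d 1) (2 * m) S ≡ false → UninfectedStrip
      bad⇒strip z bad = strip-from (d ∸ midCount lv) (midCount lv)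
        (≤-reflexive (sym (m+[n∸m]≡n (midCount-≤ lv)))) (m≤n+m _ _)
        (progress two (level-of-uninfected ∈box uninfected))
        where
          open InnerUninfected (bad⇒inner-uninfected {r = d} {2 * m} {S} z bad)
          lv = level-of point
          two : TwoMids lv
          two = twoMids i≢j (rounding-mid (rounding-at ∈box i) (proj₁ i-inner) (proj₂ i-inner))
                            (rounding-mid (rounding-at ∈box j) (proj₁ j-inner) (proj₂ j-inner))

  -- m = 2: eight uninfected vertices

  module SideFour {d : ℕ} (S : List (Pt d)) where

    open Grid {d} 2
    open Infection S

    Healthy : Vec Lvl d → Set
    Healthy μ = Uninfected (pt 2 μ)

    healthy? : Vec Lvl d → Bool
    healthy? μ = not (I (pt 2 μ))

    pt₂-injective : ∀ {μ ν : Vec Lvl d} → pt 2 μ ≡ pt 2 ν → μ ≡ ν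
    pt₂-injective {μ} {ν} e = lookup-ext μ ν λ i → value₂-injective
      (trans (sym (lookup-pt 2 μ i)) (trans (cong (λ x → lookup x i) e) (lookup-pt 2 ν i)))

    pt₂-∈D : ∀ μ → pt 2 μ ∈ D
    pt₂-∈D = pt-∈D (s≤s z≤n)

    adj-nbrs : ∀ μ {ν} → ν ∈ nbrs μ → adj (pt 2 μ) (pt 2 ν) ≡ true
    adj-nbrs μ {ν} ν∈ with ∈-nbrs⁻ {d} {μ} {ν} ν∈
    ... | (r , c , c∈ , refl) rewrite pt-[]≔ 2 μ r c =
      adj-[]≔ {x = pt 2 μ} {r} {value 2 c} (trans (cong (λ v → ∣ v - value 2 c ∣) (lookup-pt 2 μ r)) (neighbours-unit c∈))

    healthyNbrs : Vec Lvl d → List (Vec Lvl d)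
    healthyNbrs μ = filter (λ ν → healthy? ν ≟ᵇ true) (nbrs μ)

    ∈-healthyNbrs⁻ : ∀ μ {ν} → ν ∈ healthyNbrs μ → ν ∈ nbrs μ × Healthy ν
    ∈-healthyNbrs⁻ μ ν∈ with ∈-filter⁻ (λ ν → healthy? ν ≟ᵇ true) {xs = nbrs μ} ν∈
    ... | (ν∈′ , h) = ν∈′ , not-true⇒false h

    healthyNbrs-unique : ∀ μ → Unique (healthyNbrs μ)
    healthyNbrs-unique μ = Unique.filter⁺ (λ ν → healthy? ν ≟ᵇ true) (nbrs-unique μ)

    -- A level vector with k mid coordinates has d + k neighbours, at most d − 1 of them infected.
    many-healthyNbrs : ∀ μ → Healthy μ → suc (midCount μ) ≤ length (healthyNbrs μ)
    many-healthyNbrs μ healthy = +-cancelˡ-≤ ci (suc (midCount μ)) (length (healthyNbrs μ)) (begin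
      ci + suc (midCount μ)       ≡⟨ +-suc ci (midCount μ) ⟩
      suc ci + midCount μ         ≤⟨ +-monoˡ-≤ (midCount μ) few-infected ⟩
      d + midCount μ              ≡⟨ length-nbrs μ ⟨
      length (nbrs μ)             ≡⟨ count+count-not (I ∘ pt 2) (nbrs μ) ⟨
      ci + count healthy? (nbrs μ) ≡⟨ cong (ci +_) (count≡length-filter healthy? (nbrs μ)) ⟩
      ci + length (healthyNbrs μ) ∎)
      where
        open ≤-Reasoning
        ci = count (I ∘ pt 2) (nbrs μ)
        infected? = λ ν → I (pt 2 ν) ≟ᵇ true
        infected-pts = map (pt 2) (filter infected? (nbrs μ))
        length-infected-pts : length infected-pts ≡ ci
        length-infected-pts = trans (length-map (pt 2) (filter infected? (nbrs μ)))
                                    (sym (count≡length-filter (I ∘ pt 2) (nbrs μ)))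
        infected-pts-⊆ : infected-pts ⊆ D
        infected-pts-⊆ y∈ with ∈-map⁻ (pt 2) y∈
        ... | (ν , _ , refl) = pt₂-∈D ν
        infected-pts-adjacent : ∀ {y} → y ∈ infected-pts → adj (pt 2 μ) y ∧ I y ≡ true
        infected-pts-adjacent y∈ with ∈-map⁻ (pt 2) y∈
        ... | (ν , ν∈ , refl) with ∈-filter⁻ infected? {xs = nbrs μ} ν∈
        ...   | (ν∈′ , infected) = cong₂ _∧_ (adj-nbrs μ ν∈′) infected
        few-infected : ci < d
        few-infected = ≰⇒> λ d≤ci → contradiction
          (trans (sym (I-closed (pt 2 μ) (pt₂-∈D μ) (≤-trans d≤ci (≤-trans (≤-reflexive (sym length-infected-pts))
            (length≤count {P = λ y → adj (pt 2 μ) y ∧ I y}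
              (Unique.map⁺ pt₂-injective (Unique.filter⁺ infected? (nbrs-unique μ)))
              infected-pts-⊆ infected-pts-adjacent))))) healthy) λ ()

    record EightUninfected : Set where
      field
        pool       : List (Vec Lvl d)
        pool-unique : Unique pool
        eight      : 8 ≤ count healthy? pool

    eight-healthy : ∀ (L : List (Vec Lvl d)) → Unique L → All Healthy L → 8 ≤ length L →
                    EightUninfected
    eight-healthy L uL healthy 8≤ = record
      { pool = L ; pool-unique = uL
      ; eight = ≤-trans 8≤ (length≤count uL (λ ν∈ → ν∈) (λ ν∈ → cong not (All.lookup healthy ν∈))) }

    eight-from-pair : ∀ {μ ν} → ν ∈ nbrs μ → Healthy μ → Healthy ν → 3 ≤ midCount μ → 3 ≤ midCount ν →
                      EightUninfected
    eight-from-pair {μ} {ν} ν∈ hμ hν 3≤μ 3≤ν = eight-healthy (healthyNbrs μ ++ healthyNbrs ν)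
      (Unique.++⁺ (healthyNbrs-unique μ) (healthyNbrs-unique ν) opposite-parities)
      (All.tabulate λ x∈ → [ proj₂ ∘ ∈-healthyNbrs⁻ μ , proj₂ ∘ ∈-healthyNbrs⁻ ν ]′ (∈-++⁻ (healthyNbrs μ) x∈))
      (≤-trans (+-mono-≤ (≤-trans (s≤s 3≤μ) (many-healthyNbrs μ hμ)) (≤-trans (s≤s 3≤ν) (many-healthyNbrs ν hν)))
               (≤-reflexive (sym (length-++ (healthyNbrs μ)))))
      where
        opposite-parities : ∀ {x} → ¬ (x ∈ healthyNbrs μ × x ∈ healthyNbrs ν)
        opposite-parities {x} (x∈μ , x∈ν) = not-¬ refl (begin
          parity μ             ≡⟨ not-involutive (parity μ) ⟨
          not (not (parity μ)) ≡⟨ cong not (parity-nbrs {μ = μ} ν∈) ⟨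
          not (parity ν)       ≡⟨ parity-nbrs {μ = ν} (proj₁ (∈-healthyNbrs⁻ ν x∈ν)) ⟨
          parity x             ≡⟨ parity-nbrs {μ = μ} (proj₁ (∈-healthyNbrs⁻ μ x∈μ)) ⟩
          not (parity μ)       ∎)
          where open ≡-Reasoning

    infected-by-stepIn : ∀ μ → (∀ r → I (pt 2 (μ [ r ]≔ stepIn (lookup μ r))) ≡ true) → I (pt 2 μ) ≡ true
    infected-by-stepIn μ infected =
      closed-by-coordinate-moves I-closed (pt₂-∈D μ) (λ r → value 2 (stepIn (lookup μ r))) λ r →
          trans (cong (λ v → ∣ v - value 2 (stepIn (lookup μ r)) ∣) (lookup-pt 2 μ r))
                (neighbours-unit (stepIn∈neighbours (lookup μ r)))
      , subst (_∈ D) (pt-[]≔ 2 μ r (stepIn (lookup μ r))) (pt₂-∈D _)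
      , subst (λ y → I y ≡ true) (pt-[]≔ 2 μ r (stepIn (lookup μ r))) (infected r)

    eight-from-high : ∀ n μ → d ≤ midCount μ + n → 3 ≤ midCount μ → Healthy μ → EightUninfected
    eight-from-high n μ bound 3≤ healthy
      with Fin.any? (λ r → I (pt 2 (μ [ r ]≔ stepIn (lookup μ r))) ≟ᵇ false)
    ... | no all-infected =
      contradiction (trans (sym (infected-by-stepIn μ λ r → ¬-not λ h → all-infected (r , h))) healthy) λ ()
    ... | yes (r , h) with isMid (lookup μ r) in mid
    ...   | true  = eight-from-pair (∈-nbrs⁺ (stepIn∈neighbours (lookup μ r))) healthy h 3≤
                      (≤-trans 3≤ (≤-reflexive (sym (midCount-[]≔ μ (trans (stepIn-mid _) (sym mid))))))
    ...   | false = climb n bound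
      where
        ν = μ [ r ]≔ stepIn (lookup μ r)
        more : midCount μ < midCount ν
        more = midCount-< μ mid (stepIn-mid _)
        climb : ∀ n → d ≤ midCount μ + n → EightUninfected
        climb zero    bound =
          ⊥-elim (1+n≰n (≤-trans more (≤-trans (midCount-≤ ν) (≤-trans bound (≤-reflexive (+-identityʳ _))))))
        climb (suc n) bound = eight-from-high n ν
          (≤-trans bound (≤-trans (≤-reflexive (+-suc (midCount μ) n)) (+-monoˡ-≤ n more))) (≤-trans 3≤ (<⇒≤ more)) h

    module Plane (μ : Vec Lvl d) {a b : Fin d} (a≢b : a ≢ b)
                 (others-nonmid : ∀ r → r ≢ a → r ≢ b → isMid (lookup μ r) ≡ false) where

      plane : Lvl → Lvl → Vec Lvl d
      plane A B = μ [ a ]≔ A [ b ]≔ B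

      plane-a : ∀ A B → lookup (plane A B) a ≡ A
      plane-a A B = trans (lookup∘update′ a≢b (μ [ a ]≔ A) B) (lookup∘update a μ A)

      plane-b : ∀ A B → lookup (plane A B) b ≡ B
      plane-b A B = lookup∘update b (μ [ a ]≔ A) B

      plane-other : ∀ A B {r} → r ≢ a → r ≢ b → lookup (plane A B) r ≡ lookup μ r
      plane-other A B r≢a r≢b = trans (lookup∘update′ r≢b (μ [ a ]≔ A) B) (lookup∘update′ r≢a μ A)

      plane-[a] : ∀ A B A′ → plane A B [ a ]≔ A′ ≡ plane A′ B
      plane-[a] A B A′ = trans ([]≔-commutes (μ [ a ]≔ A) b a (a≢b ∘ sym)) (cong (_[ b ]≔ B) ([]≔-idempotent μ a))

      plane-[b] : ∀ A B B′ → plane A B [ b ]≔ B′ ≡ plane A B′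
      plane-[b] A B B′ = []≔-idempotent (μ [ a ]≔ A) b

      plane-μ : plane (lookup μ a) (lookup μ b) ≡ μ
      plane-μ = trans (cong (_[ b ]≔ lookup μ b) ([]≔-lookup μ a)) ([]≔-lookup μ b)

      plane-≢ᵃ : ∀ {x A B} → lookup x a ≢ A → x ≢ plane A B
      plane-≢ᵃ {A = A} {B} xa≢A refl = xa≢A (plane-a A B)

      plane-≢ᵇ : ∀ {x A B} → lookup x b ≢ B → x ≢ plane A B
      plane-≢ᵇ {A = A} {B} xb≢B refl = xb≢B (plane-b A B)

      plane-injective : ∀ {p q : Lvl × Lvl} → plane (proj₁ p) (proj₂ p) ≡ plane (proj₁ q) (proj₂ q) → p ≡ q
      plane-injective {A , B} {A′ , B′} e = cong₂ _,_
        (trans (sym (plane-a A B)) (trans (cong (λ x → lookup x a) e) (plane-a A′ B′)))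
        (trans (sym (plane-b A B)) (trans (cong (λ x → lookup x b) e) (plane-b A′ B′)))

      OffPlaneInfected : Lvl → Lvl → Set
      OffPlaneInfected A B = ∀ r → r ≢ a → r ≢ b → I (pt 2 (plane A B [ r ]≔ stepIn (lookup μ r))) ≡ true

      two-mids : ∀ {A B} → isMid A ≡ true → isMid B ≡ true → 2 ≤ midCount (plane A B)
      two-mids {A} {B} mA mB = midCount-≥ (plane A B) (a ∷ b ∷ []) ((a≢b All.∷ All.[]) ∷ All.[] ∷ AllPairs.[]) mids
        where
          mids : ∀ {i} → i ∈ a ∷ b ∷ [] → isMid (lookup (plane A B) i) ≡ true
          mids (here refl)         = trans (cong isMid (plane-a A B)) mA
          mids (there (here refl)) = trans (cong isMid (plane-b A B)) mB

      offPlaneInfected-or-eight : ∀ {A B} → isMid A ≡ true → isMid B ≡ true →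
                                  EightUninfected ⊎ OffPlaneInfected A B
      offPlaneInfected-or-eight {A} {B} mA mB
        with Fin.any? (λ r → ¬? (r Fin.≟ a) ×-dec ¬? (r Fin.≟ b)
                             ×-dec (I (pt 2 (plane A B [ r ]≔ stepIn (lookup μ r))) ≟ᵇ false))
      ... | no none = inj₂ λ r r≢a r≢b → ¬-not λ h → none (r , r≢a , r≢b , h)
      ... | yes (r , r≢a , r≢b , h) =
        inj₁ (eight-from-high (d ∸ midCount ν) ν (≤-reflexive (sym (m+[n∸m]≡n (midCount-≤ ν)))) three-mids h)
        where
          ν = plane A B [ r ]≔ stepIn (lookup μ r)
          three-mids : 3 ≤ midCount ν
          three-mids = midCount-≥ ν (a ∷ b ∷ r ∷ [])
            ((a≢b All.∷ (r≢a ∘ sym) All.∷ All.[]) ∷ ((r≢b ∘ sym) All.∷ All.[]) ∷ All.[] ∷ AllPairs.[]) mids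
            where
              mids : ∀ {i} → i ∈ a ∷ b ∷ r ∷ [] → isMid (lookup ν i) ≡ true
              mids (here refl) = trans (cong isMid (trans (lookup∘update′ (r≢a ∘ sym) (plane A B) _) (plane-a A B))) mA
              mids (there (here refl)) =
                trans (cong isMid (trans (lookup∘update′ (r≢b ∘ sym) (plane A B) _) (plane-b A B))) mB
              mids (there (there (here refl))) = trans (cong isMid (lookup∘update r (plane A B) _)) (stepIn-mid _)

      planeMoves : Lvl → Lvl → List (Vec Lvl d)
      planeMoves A B = plane (flipMid A) B ∷ plane (outward A) B ∷ plane A (flipMid B) ∷ plane A (outward B) ∷ []

      healthy-nbrs-in-plane : ∀ {A B} → isMid A ≡ true → isMid B ≡ true → OffPlaneInfected A B →
                              ∀ {ν} → ν ∈ healthyNbrs (plane A B) → ν ∈ planeMoves A B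
      healthy-nbrs-in-plane {A} {B} mA mB off ν∈ with ∈-healthyNbrs⁻ (plane A B) ν∈
      ... | (ν∈′ , hν) with ∈-nbrs⁻ {d} {plane A B} ν∈′
      ... | (r , c , c∈ , refl) with r Fin.≟ a | r Fin.≟ b
      ...   | yes refl | _ with mid-neighbours mA (subst (λ l → c ∈ neighbours l) (plane-a A B) c∈)
      ...     | inj₁ refl = here (plane-[a] A B _)
      ...     | inj₂ refl = there (here (plane-[a] A B _))
      healthy-nbrs-in-plane {A} {B} mA mB off ν∈ | (ν∈′ , hν) | (r , c , c∈ , refl) | no _ | yes refl
        with mid-neighbours mB (subst (λ l → c ∈ neighbours l) (plane-b A B) c∈)
      ...     | inj₁ refl = there (there (here (plane-[b] A B _)))
      ...     | inj₂ refl = there (there (there (here (plane-[b] A B _))))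
      healthy-nbrs-in-plane {A} {B} mA mB off ν∈ | (ν∈′ , hν) | (r , c , c∈ , refl) | no r≢a | no r≢b
        with nonmid-neighbours (others-nonmid r r≢a r≢b)
                               (subst (λ l → c ∈ neighbours l) (plane-other A B r≢a r≢b) c∈)
      ...     | refl = contradiction (trans (sym (off r r≢a r≢b)) hν) λ ()

      at-most-one-infected : ∀ {A B} → isMid A ≡ true → isMid B ≡ true → OffPlaneInfected A B → Healthy (plane A B) →
                             count (I ∘ pt 2) (planeMoves A B) ≤ 1
      at-most-one-infected {A} {B} mA mB off healthy = +-cancelʳ-≤ 3 _ _ (begin
        ci + 3                                           ≤⟨ +-monoʳ-≤ ci (≤-trans (s≤s (two-mids mA mB)) (many-healthyNbrs (plane A B) healthy)) ⟩
        ci + length (healthyNbrs (plane A B))               ≤⟨ +-monoʳ-≤ ci (length≤count (healthyNbrs-unique (plane A B))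
                                                              (healthy-nbrs-in-plane mA mB off)
                                                              (λ ν∈ → cong not (proj₂ (∈-healthyNbrs⁻ (plane A B) ν∈)))) ⟩
        ci + count healthy? (planeMoves A B)             ≡⟨ count+count-not (I ∘ pt 2) (planeMoves A B) ⟩
        4                                                ∎)
        where
          open ≤-Reasoning
          ci = count (I ∘ pt 2) (planeMoves A B)

      one-of-two-healthy : ∀ {A B} → isMid A ≡ true → isMid B ≡ true → OffPlaneInfected A B → Healthy (plane A B) →
                   ∀ {ν₁ ν₂} → ν₁ ∈ planeMoves A B → ν₂ ∈ planeMoves A B → ν₁ ≢ ν₂ → Healthy ν₁ ⊎ Healthy ν₂
      one-of-two-healthy mA mB off healthy {ν₁} {ν₂} ν₁∈ ν₂∈ ν₁≢ν₂ with I (pt 2 ν₁) in e₁ | I (pt 2 ν₂) in e₂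
      ... | false | _     = inj₁ refl
      ... | true  | false = inj₂ refl
      ... | true  | true  = ⊥-elim (1+n≰n (≤-trans
        (length≤count {P = I ∘ pt 2} ((ν₁≢ν₂ All.∷ All.[]) ∷ All.[] ∷ AllPairs.[])
          (λ { (here refl) → ν₁∈ ; (there (here refl)) → ν₂∈ })
          (λ { (here refl) → e₁ ; (there (here refl)) → e₂ }))
        (at-most-one-infected mA mB off healthy)))

      other-healthy : ∀ {ν₁ ν₂} → Healthy ν₁ ⊎ Healthy ν₂ → I (pt 2 ν₁) ≡ true → Healthy ν₂
      other-healthy (inj₁ h₁) i₁ = contradiction (trans (sym i₁) h₁) λ ()
      other-healthy (inj₂ h₂) _  = h₂

      some-out-healthy : ∀ {A B} → isMid A ≡ true → isMid B ≡ true → OffPlaneInfected A B → Healthy (plane A B) →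
                         Healthy (plane (outward A) B) ⊎ Healthy (plane A (outward B))
      some-out-healthy {A} {B} mA mB off h =
        one-of-two-healthy mA mB off h (there (here refl)) (there (there (there (here refl))))
        (plane-≢ᵃ (λ e → mid≢nonmid mA (isMid-outward mA) (sym (trans (sym (plane-a (outward A) B)) e))))

      outs-healthy-if-flipβ-infected : ∀ {A B} → isMid A ≡ true → isMid B ≡ true → OffPlaneInfected A B → Healthy (plane A B) →
        I (pt 2 (plane A (flipMid B))) ≡ true → Healthy (plane (outward A) B) × Healthy (plane A (outward B))
      outs-healthy-if-flipβ-infected {A} {B} mA mB off h flipβ-infected =
          other-healthy (one-of-two-healthy mA mB off h (there (there (here refl))) (there (here refl))
                          (plane-≢ᵃ (λ e → mid≢nonmid mA (isMid-outward mA) (trans (sym (plane-a A (flipMid B))) e))))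
                        flipβ-infected
        , other-healthy (one-of-two-healthy mA mB off h (there (there (here refl))) (there (there (there (here refl))))
                          (plane-≢ᵇ (λ e → mid≢nonmid (trans (isMid-flipMid B) mB) (isMid-outward mB)
                                          (trans (sym (plane-b A (flipMid B))) e))))
                        flipβ-infected

      outs-healthy-if-flipα-infected : ∀ {A B} → isMid A ≡ true → isMid B ≡ true → OffPlaneInfected A B → Healthy (plane A B) →
        I (pt 2 (plane (flipMid A) B)) ≡ true → Healthy (plane (outward A) B) × Healthy (plane A (outward B))
      outs-healthy-if-flipα-infected {A} {B} mA mB off h flipα-infected =
          other-healthy (one-of-two-healthy mA mB off h (here refl) (there (here refl))
                          (plane-≢ᵃ (λ e → mid≢nonmid (trans (isMid-flipMid A) mA) (isMid-outward mA)
                                          (trans (sym (plane-a (flipMid A) B)) e))))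
                        flipα-infected
        , other-healthy (one-of-two-healthy mA mB off h (here refl) (there (there (there (here refl))))
                          (plane-≢ᵇ (λ e → mid≢nonmid mB (isMid-outward mB) (trans (sym (plane-b (flipMid A) B)) e))))
                        flipα-infected

      toPlane : Lvl × Lvl → Vec Lvl d
      toPlane p = plane (proj₁ p) (proj₂ p)

      eight-from-block : ∀ {A B} → isMid A ≡ true → isMid B ≡ true →
        let P = healthy? ∘ toPlane in
        8 ≤ count P (cell A B) + count P (cell (flipMid A) B) + count P (cell A (flipMid B))
            + count P (cell (flipMid A) (flipMid B)) →
        EightUninfected
      eight-from-block {A} {B} mA mB 8≤ = record
        { pool = map toPlane (block A B)
        ; pool-unique = Unique.map⁺ plane-injective (block-unique mA mB)
        ; eight = ≤-trans 8≤ (≤-reflexive (sym (trans (count-map healthy? toPlane (block A B))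
                                                       (count-block (healthy? ∘ toPlane) A B)))) }

      healthy?-true : ∀ {ν} → Healthy ν → healthy? ν ≡ true
      healthy?-true h = cong not h

      cell-≥2 : ∀ {A B} → isMid A ≡ true → isMid B ≡ true → OffPlaneInfected A B → Healthy (plane A B) →
                2 ≤ count (healthy? ∘ toPlane) (cell A B)
      cell-≥2 mA mB off h = count-≥2 (healthy? ∘ toPlane) (healthy?-true h)
        (Data.Sum.map healthy?-true healthy?-true (some-out-healthy mA mB off h))

      cell-≥3 : ∀ {A B} → Healthy (plane A B) → Healthy (plane (outward A) B) × Healthy (plane A (outward B)) →
                3 ≤ count (healthy? ∘ toPlane) (cell A B)
      cell-≥3 h (hα , hβ) = count-≥3 (healthy? ∘ toPlane) (healthy?-true h) (healthy?-true hα) (healthy?-true hβ)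

      square-healthy : ∀ {A B} → isMid A ≡ true → isMid B ≡ true →
        Healthy (plane A B) → Healthy (plane (flipMid A) B) →
        Healthy (plane A (flipMid B)) → Healthy (plane (flipMid A) (flipMid B)) →
        OffPlaneInfected A B → OffPlaneInfected (flipMid A) B →
        OffPlaneInfected A (flipMid B) → OffPlaneInfected (flipMid A) (flipMid B) → EightUninfected
      square-healthy mA mB h₀₀ h₁₀ h₀₁ h₁₁ s₀₀ s₁₀ s₀₁ s₁₁ = eight-from-block mA mB
        (+-mono-≤ (+-mono-≤ (+-mono-≤ (cell-≥2 mA mB s₀₀ h₀₀) (cell-≥2 mfA mB s₁₀ h₁₀))
                            (cell-≥2 mA mfB s₀₁ h₀₁)) (cell-≥2 mfA mfB s₁₁ h₁₁))
        where
          mfA = trans (isMid-flipMid _) mA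
          mfB = trans (isMid-flipMid _) mB

      square-three-healthy : ∀ {A B} → isMid A ≡ true → isMid B ≡ true →
        Healthy (plane A B) → Healthy (plane (flipMid A) B) → Healthy (plane A (flipMid B)) →
        I (pt 2 (plane (flipMid A) (flipMid B))) ≡ true →
        OffPlaneInfected A B → OffPlaneInfected (flipMid A) B → OffPlaneInfected A (flipMid B) → EightUninfected
      square-three-healthy mA mB h₀₀ h₁₀ h₀₁ i₁₁ s₀₀ s₁₀ s₀₁ = eight-from-block mA mB
        (≤-trans (+-mono-≤ (+-mono-≤ (cell-≥2 mA mB s₀₀ h₀₀)
                                      (cell-≥3 h₁₀ (outs-healthy-if-flipβ-infected mfA mB s₁₀ h₁₀ i₁₁)))
                           (cell-≥3 h₀₁ (outs-healthy-if-flipα-infected mA mfB s₀₁ h₀₁ i₁₁)))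
                 (m≤m+n _ _))
        where
          mfA = trans (isMid-flipMid _) mA
          mfB = trans (isMid-flipMid _) mB

      a-move : ∀ {ν₀ ν} → isMid (lookup ν₀ a) ≡ false → ν ∈ nbrs ν₀ → lookup ν a ≢ lookup ν₀ a →
               ν ≡ ν₀ [ a ]≔ stepIn (lookup ν₀ a)
      a-move {ν₀} nonmid ν∈ moved with ∈-nbrs⁻ {d} {ν₀} ν∈
      ... | (r , c , c∈ , refl) with r Fin.≟ a
      ...   | yes refl = cong (ν₀ [ r ]≔_) (nonmid-neighbours nonmid c∈)
      ...   | no r≢a   = contradiction (lookup∘update′ (r≢a ∘ sym) ν₀ c) moved

      another-healthy-nbr : ∀ ν₀ → isMid (lookup ν₀ a) ≡ false → 1 ≤ midCount ν₀ → Healthy ν₀ →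
                            ∃[ x ] Healthy x × x ∈ nbrs ν₀ × lookup x a ≡ lookup ν₀ a
      another-healthy-nbr ν₀ nonmid 1≤ h
        with healthyNbrs ν₀ | healthyNbrs-unique ν₀ | ≤-trans (s≤s 1≤) (many-healthyNbrs ν₀ h) | ∈-healthyNbrs⁻ ν₀
      ... | x₁ ∷ [] | _ | s≤s () | _
      ... | x₁ ∷ x₂ ∷ _ | x₁∉ ∷ _ | _ | mem with lookup x₁ a ≟ₗ lookup ν₀ a | lookup x₂ a ≟ₗ lookup ν₀ a
      ...   | yes e  | _      = x₁ , proj₂ (mem (here refl)) , proj₁ (mem (here refl)) , e
      ...   | no _   | yes e  = x₂ , proj₂ (mem (there (here refl))) , proj₁ (mem (there (here refl))) , e
      ...   | no n₁  | no n₂  = ⊥-elim (All.head x₁∉ (trans (a-move {ν₀} nonmid (proj₁ (mem (here refl))) n₁)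
                                                      (sym (a-move {ν₀} nonmid (proj₁ (mem (there (here refl)))) n₂))))

      a-fresh : ∀ {x X A′ B′} → lookup x a ≡ X → X ≢ A′ → x ≢ plane A′ B′
      a-fresh xa X≢A′ = plane-≢ᵃ (λ e → X≢A′ (trans (sym xa) e))

      healthy-nbr-off-a-line : ∀ {X B} → isMid X ≡ true → isMid B ≡ true → Healthy (plane (outward X) B) →
        ∃[ x ] Healthy x × x ∈ nbrs (plane (outward X) B) × lookup x a ≡ outward X
      healthy-nbr-off-a-line {X} {B} mX mB h
        with another-healthy-nbr (plane (outward X) B) (trans (cong isMid (plane-a (outward X) B)) (isMid-outward mX))
               (midCount-≥ (plane (outward X) B) (b ∷ []) (All.[] ∷ AllPairs.[])
                           λ { (here refl) → trans (cong isMid (plane-b (outward X) B)) mB })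
               h
      ... | (x , hx , x∈ , xa) = x , hx , x∈ , trans xa (plane-a (outward X) B)

      row-pool-unique : ∀ {A B x x′} → isMid A ≡ true → isMid B ≡ true →
        x ∈ nbrs (plane (outward A) B) → lookup x a ≡ outward A →
        x′ ∈ nbrs (plane (outward (flipMid A)) B) → lookup x′ a ≡ outward (flipMid A) →
        Unique (x ∷ x′ ∷ map toPlane (cell A B ++ cell (flipMid A) B))
      row-pool-unique {A} {B} mA mB x∈ xa x′∈ x′a =
          (  (λ e → outward-flipMid≢ mA (trans (sym x′a) (trans (cong (λ y → lookup y a) (sym e)) xa)))
        All.∷ a-fresh xa oA≢A
        All.∷ nbrs-irreflexive x∈
        All.∷ a-fresh xa oA≢A
        All.∷ a-fresh xa oA≢fA
        All.∷ a-fresh xa (outward-flipMid≢ mA ∘ sym)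
        All.∷ a-fresh xa oA≢fA
        All.∷ All.[])
        ∷ (  a-fresh x′a ofA≢A
        All.∷ a-fresh x′a (outward-flipMid≢ mA)
        All.∷ a-fresh x′a ofA≢A
        All.∷ a-fresh x′a ofA≢fA
        All.∷ nbrs-irreflexive x′∈
        All.∷ a-fresh x′a ofA≢fA
        All.∷ All.[])
        ∷ Unique.map⁺ plane-injective (Unique.take⁺ 6 (block-unique mA mB))
        where
          mfA = trans (isMid-flipMid A) mA
          oA≢A : outward A ≢ A
          oA≢A e = mid≢nonmid mA (isMid-outward mA) (sym e)
          oA≢fA : outward A ≢ flipMid A
          oA≢fA e = mid≢nonmid mfA (isMid-outward mA) (sym e)
          ofA≢A : outward (flipMid A) ≢ A
          ofA≢A e = mid≢nonmid mA (isMid-outward mfA) (sym e)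
          ofA≢fA : outward (flipMid A) ≢ flipMid A
          ofA≢fA e = mid≢nonmid mfA (isMid-outward mfA) (sym e)

      -- Six vertices of the plane are forced; the other two are healthy neighbours, off the a-line,
      -- of the outward points plane (outward A) B and plane (outward (flipMid A)) B.
      square-row-healthy : ∀ {A B} → isMid A ≡ true → isMid B ≡ true →
        Healthy (plane A B) → Healthy (plane (flipMid A) B) →
        I (pt 2 (plane A (flipMid B))) ≡ true → I (pt 2 (plane (flipMid A) (flipMid B))) ≡ true →
        OffPlaneInfected A B → OffPlaneInfected (flipMid A) B → EightUninfected
      square-row-healthy {A} {B} mA mB h₀₀ h₁₀ i₀₁ i₁₁ o₀₀ o₁₀ =
        row-eight (healthy-nbr-off-a-line mA mB (proj₁ outs₀)) (healthy-nbr-off-a-line mfA mB (proj₁ outs₁))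
        where
          mfA = trans (isMid-flipMid A) mA
          outs₀ = outs-healthy-if-flipβ-infected mA mB o₀₀ h₀₀ i₀₁
          outs₁ = outs-healthy-if-flipβ-infected mfA mB o₁₀ h₁₀ i₁₁
          row-eight : (∃[ x ] Healthy x × x ∈ nbrs (plane (outward A) B) × lookup x a ≡ outward A) →
                      (∃[ x ] Healthy x × x ∈ nbrs (plane (outward (flipMid A)) B) × lookup x a ≡ outward (flipMid A)) →
                      EightUninfected
          row-eight (x , hx , x∈ , xa) (x′ , hx′ , x′∈ , x′a) =
            eight-healthy (x ∷ x′ ∷ map toPlane (cell A B ++ cell (flipMid A) B)) (row-pool-unique mA mB x∈ xa x′∈ x′a)
              (hx All.∷ hx′ All.∷ h₀₀ All.∷ proj₁ outs₀ All.∷ proj₂ outs₀ All.∷ h₁₀ All.∷ proj₁ outs₁ All.∷ proj₂ outs₁ All.∷ All.[])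
              ≤-refl

      eight-from-row : ∀ {A B} → isMid A ≡ true → isMid B ≡ true →
                       Healthy (plane A B) → Healthy (plane (flipMid A) B) → EightUninfected
      eight-from-row {A} {B} mA mB h₀₀ h₁₀ with offPlaneInfected-or-eight mA mB | offPlaneInfected-or-eight mfA mB
        where
          mfA = trans (isMid-flipMid A) mA
      ... | inj₁ e   | _        = e
      ... | inj₂ _   | inj₁ e   = e
      ... | inj₂ s₀₀ | inj₂ s₁₀
        with I (pt 2 (plane A (flipMid B))) in e₀₁ | I (pt 2 (plane (flipMid A) (flipMid B))) in e₁₁
      ...   | true  | true  = square-row-healthy mA mB h₀₀ h₁₀ e₀₁ e₁₁ s₀₀ s₁₀
      ...   | false | true  = [ (λ e → e) , square-three-healthy mA mB h₀₀ h₁₀ e₀₁ e₁₁ s₀₀ s₁₀ ]′ (offPlaneInfected-or-eight mA mfB)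
        where
          mfB = trans (isMid-flipMid B) mB
      ...   | true  | false = [ (λ e → e) , square-three-healthy mfA mB h₁₀ (back Healthy′ h₀₀) e₁₁ (back Infected′ e₀₁) s₁₀
                                              (back (λ X → OffPlaneInfected X B) s₀₀) ]′ (offPlaneInfected-or-eight mfA mfB)
        where
          mfA = trans (isMid-flipMid A) mA
          mfB = trans (isMid-flipMid B) mB
          back : ∀ (P : Lvl → Set) → P A → P (flipMid (flipMid A))
          back P = subst P (sym (flipMid-involutive A))
          Healthy′ = λ X → Healthy (plane X B)
          Infected′ = λ X → I (pt 2 (plane X (flipMid B))) ≡ true
      ...   | false | false with offPlaneInfected-or-eight mA mfB | offPlaneInfected-or-eight mfA mfB
        where
          mfA = trans (isMid-flipMid A) mA
          mfB = trans (isMid-flipMid B) mB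
      ...     | inj₁ e   | _        = e
      ...     | inj₂ _   | inj₁ e   = e
      ...     | inj₂ s₀₁ | inj₂ s₁₁ = square-healthy mA mB h₀₀ h₁₀ e₀₁ e₁₁ s₀₀ s₁₀ s₀₁ s₁₁

      eight-or-flipβ : isMid (lookup μ a) ≡ true → isMid (lookup μ b) ≡ true → Healthy μ →
                       EightUninfected ⊎ Healthy (plane (lookup μ a) (flipMid (lookup μ b)))
      eight-or-flipβ ma mb h with offPlaneInfected-or-eight ma mb
      ... | inj₁ e = inj₁ e
      ... | inj₂ s with one-of-two-healthy ma mb s h₀ (here refl) (there (there (here refl)))
                          (plane-≢ᵃ (λ e → flipMid≢ ma (trans (sym (plane-a (flipMid (lookup μ a)) (lookup μ b))) e)))
        where
          h₀ = subst Healthy (sym plane-μ) h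
      ...   | inj₁ hα = inj₁ (eight-from-row ma mb (subst Healthy (sym plane-μ) h) hα)
      ...   | inj₂ hβ = inj₂ hβ

    eight-from-two-mids : ∀ μ → TwoMids μ → Healthy μ → EightUninfected
    eight-from-two-mids μ (twoMids {p} {q} p≢q mp mq) h
      with Fin.any? (λ r → ¬? (r Fin.≟ p) ×-dec ¬? (r Fin.≟ q) ×-dec (isMid (lookup μ r) ≟ᵇ true))
    ... | yes (r , r≢p , r≢q , mr) =
      eight-from-high (d ∸ midCount μ) μ (≤-reflexive (sym (m+[n∸m]≡n (midCount-≤ μ)))) three-mids h
      where
        three-mids : 3 ≤ midCount μ
        three-mids = midCount-≥ μ (p ∷ q ∷ r ∷ [])
          ((p≢q All.∷ (r≢p ∘ sym) All.∷ All.[]) ∷ ((r≢q ∘ sym) All.∷ All.[]) ∷ All.[] ∷ AllPairs.[])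
          λ { (here refl) → mp ; (there (here refl)) → mq ; (there (there (here refl))) → mr }
    ... | no none with Plane.eight-or-flipβ μ p≢q others mp mq h
      where
        others : ∀ r → r ≢ p → r ≢ q → isMid (lookup μ r) ≡ false
        others r r≢p r≢q = ¬-not λ mr → none (r , r≢p , r≢q , mr)
    ...   | inj₁ e  = e
    ...   | inj₂ hβ = Plane.eight-from-row μ (p≢q ∘ sym) (λ r r≢q r≢p → others r r≢p r≢q) mq mp
                        (subst Healthy (sym (Plane.plane-μ μ (p≢q ∘ sym) (λ r r≢q r≢p → others r r≢p r≢q))) h)
                        (subst Healthy (sym ([]≔-commutes μ q p (p≢q ∘ sym))) hβ)
      where
        others : ∀ r → r ≢ p → r ≢ q → isMid (lookup μ r) ≡ false
        others r r≢p r≢q = ¬-not λ mr → none (r , r≢p , r≢q , mr)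

    level₂ : ℕ → Lvl
    level₂ 1 = bot
    level₂ 2 = mid₁
    level₂ 3 = mid₂
    level₂ _ = top

    value-level₂ : ∀ {t} → 1 ≤ t → t ≤ 4 → value 2 (level₂ t) ≡ t
    value-level₂ {1} _ _ = refl
    value-level₂ {2} _ _ = refl
    value-level₂ {3} _ _ = refl
    value-level₂ {4} _ _ = refl
    value-level₂ {suc (suc (suc (suc (suc _))))} _ (s≤s (s≤s (s≤s (s≤s ()))))

    level₂-mid : ∀ {t} → 1 ≤ t → t ≤ 4 → t ≢ 1 → t ≢ 4 → isMid (level₂ t) ≡ true
    level₂-mid {1} _ _ t≢1 _ = contradiction refl t≢1
    level₂-mid {2} _ _ _ _ = refl
    level₂-mid {3} _ _ _ _ = refl
    level₂-mid {4} _ _ _ t≢4 = contradiction refl t≢4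
    level₂-mid {suc (suc (suc (suc (suc _))))} _ (s≤s (s≤s (s≤s (s≤s ())))) _ _

    bad⇒eight : Fin d → good d (replicate d 1) 4 S ≡ false → EightUninfected
    bad⇒eight z bad = eight-from-two-mids μ
      (twoMids i≢j (mid-at i i-inner) (mid-at j j-inner)) (subst Uninfected (sym pt-μ) uninfected)
      where
        open InnerUninfected (bad⇒inner-uninfected {r = d} {4} {S} z bad)
        μ = Vec.map level₂ point
        pt-μ : pt 2 μ ≡ point
        pt-μ = lookup-ext (pt 2 μ) point λ r →
          trans (lookup-pt 2 μ r) (trans (cong (value 2) (lookup-map r level₂ point))
                                         (value-level₂ (proj₁ (∈D⁻ ∈box r)) (proj₂ (∈D⁻ ∈box r))))
        mid-at : ∀ r → lookup point r ≢ 1 × lookup point r ≢ 4 → isMid (lookup μ r) ≡ true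
        mid-at r (≢1 , ≢4) = trans (cong isMid (lookup-map r level₂ point))
                                   (level₂-mid (proj₁ (∈D⁻ ∈box r)) (proj₂ (∈D⁻ ∈box r)) ≢1 ≢4)

    uninfectedPts : List (Pt d)
    uninfectedPts = filter (λ y → not (I y) ≟ᵇ true) D

    eight⇒many-uninfected : EightUninfected → 8 ≤ count (λ y → memb y uninfectedPts) D
    eight⇒many-uninfected e = ≤-trans eight (≤-trans (≤-reflexive (trans (count≡length-filter healthy? pool)
      (sym (length-map (pt 2) (filter (λ ν → healthy? ν ≟ᵇ true) pool)))))
      (length≤count (Unique.map⁺ pt₂-injective (Unique.filter⁺ (λ ν → healthy? ν ≟ᵇ true) pool-unique))
        (λ y∈ → let (ν , _ , y≡) = ∈-map⁻ (pt 2) y∈ in subst (_∈ D) (sym y≡) (pt₂-∈D ν))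
        (λ y∈ → let (ν , ν∈ , y≡) = ∈-map⁻ (pt 2) y∈ in
          ∈⇒memb (∈-filter⁺ (λ y → not (I y) ≟ᵇ true) (subst (_∈ D) (sym y≡) (pt₂-∈D ν))
                   (subst (λ y → not (I y) ≡ true) (sym y≡)
                          (proj₂ (∈-filter⁻ (λ ν → healthy? ν ≟ᵇ true) {xs = pool} ν∈)))))))
      where open EightUninfected e

  subsets-⊆ : ∀ {A : Set} (V : List A) {S} → S ∈ subsets V → S ⊆ V
  subsets-⊆ [] (here refl) ()
  subsets-⊆ (x ∷ V) S∈ y∈ with ∈-++⁻ (map (x ∷_) (subsets V)) S∈
  ... | inj₂ S∈′ = there (subsets-⊆ V S∈′ y∈)
  ... | inj₁ S∈′ with ∈-map⁻ (x ∷_) S∈′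
  ...   | (S′ , S′∈ , refl) with y∈
  ...     | here refl = here refl
  ...     | there y∈′ = there (subsets-⊆ V S′∈ y∈′)

  filter-∈-subsets : ∀ {A : Set} (P : A → Bool) (xs : List A) → filter (λ x → P x ≟ᵇ true) xs ∈ subsets xs
  filter-∈-subsets P [] = here refl
  filter-∈-subsets P (x ∷ xs) with P x
  ... | true  = ∈-++⁺ˡ (∈-map⁺ (x ∷_) (filter-∈-subsets P xs))
  ... | false = ∈-++⁺ʳ (map (x ∷_) (subsets xs)) (filter-∈-subsets P xs)

  allLevels : ∀ n → List (Vec Lvl n)
  allLevels zero    = [] ∷ []
  allLevels (suc n) = cartesianProductWith _∷_ (bot ∷ mid₁ ∷ mid₂ ∷ top ∷ []) (allLevels n)

  ∈-allLevels : ∀ {n} (l : Vec Lvl n) → l ∈ allLevels n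
  ∈-allLevels []      = here refl
  ∈-allLevels (v ∷ l) = ∈-cartesianProductWith⁺ _∷_ (level∈ v) (∈-allLevels l)
    where
      level∈ : ∀ v → v ∈ bot ∷ mid₁ ∷ mid₂ ∷ top ∷ []
      level∈ bot  = here refl
      level∈ mid₁ = there (here refl)
      level∈ mid₂ = there (there (here refl))
      level∈ top  = there (there (there (here refl)))

  StripIndex : ℕ → Set
  StripIndex d = Fin d × Fin d × Vec Lvl d

  stripIndices : ∀ d → List (StripIndex d)
  stripIndices d = cartesianProduct (allFin d) (cartesianProduct (allFin d) (allLevels d))

  inStrip : ∀ {d} → ℕ → StripIndex d → Pt d → Bool
  inStrip k (j , i , l) y = memb y (LargeSide.strip k l j i)

  inList : List (Pt d) → Pt d → Bool
  inList F y = memb y F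

  bad-parts : ∀ d m S → badEvent d m S ≡ true →
              good d (replicate d 1) (2 * m) S ≡ false × all (λ a → good d a m S) (corners d m) ≡ true
  bad-parts d m S bad = not-true⇒false (∧-conicalˡ (not (good d (replicate d 1) (2 * m) S)) _ bad) , ∧-conicalʳ _ _ bad

  side-two-cube-good : ∀ {d} → Fin d → ∀ S → good d (replicate d 1) 2 S ≡ true
  side-two-cube-good {d} z S with good d (replicate d 1) 2 S in e
  ... | true  = refl
  ... | false = ⊥-elim (no-inner (proj₁ (∈-box⁻ ∈box i)) (proj₂ (∈-box⁻ ∈box i)) i-inner)
    where
      open InnerUninfected (bad⇒inner-uninfected {r = d} {2} {S} z e)
      no-inner : ∀ {t} → 1 ≤ t → t ≤ 2 → ¬ (t ≢ 1 × t ≢ 2)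
      no-inner {1} _ _ (≢1 , _) = ≢1 refl
      no-inner {2} _ _ (_ , ≢2) = ≢2 refl
      no-inner {suc (suc (suc _))} _ (s≤s (s≤s ())) _

  large-side-witness : ∀ {d} → Fin d → ∀ k S → S ∈ subsets (grid d (3 + k)) → badEvent d (3 + k) S ≡ true →
    ∃[ F ] F ∈ stripIndices d × 4 * (3 + k) ≤ count (inStrip k F) (grid d (3 + k)) × avoids (inStrip k F) S ≡ true
  large-side-witness {d} z k S S∈ bad =
    (dir , across , lvl) ,
    ∈-cartesianProduct⁺ (∈-allFin dir) (∈-cartesianProduct⁺ (∈-allFin across) (∈-allLevels lvl)) ,
    subst (_≤ count (inStrip k (dir , across , lvl)) (grid d (3 + k))) (length-strip lvl dir across)
          (length≤count (strip-unique lvl dir across across≢dir) (strip-⊆ lvl dir across) ∈⇒memb) ,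
    Grid.Infection.avoids-uninfected (3 + k) S (subsets-⊆ _ S∈) (inStrip k (dir , across , lvl))
          (λ e → uninfected (memb⇒∈ _ e))
    where
      open LargeSide {d} k
      open UninfectedStrip (bad⇒strip S (proj₂ (bad-parts d (3 + k) S bad)) z (proj₁ (bad-parts d (3 + k) S bad)))

  small-side-witness : ∀ {d} → Fin d → ∀ S → S ∈ subsets (grid d 2) → badEvent d 2 S ≡ true →
    ∃[ F ] F ∈ subsets (grid d 2) × 4 * 2 ≤ count (inList F) (grid d 2) × avoids (inList F) S ≡ true
  small-side-witness {d} z S S∈ bad =
    uninfectedPts , filter-∈-subsets (λ y → not (I y)) D ,
    eight⇒many-uninfected (bad⇒eight z (proj₁ (bad-parts d 2 S bad))) ,
    avoids-uninfected (subsets-⊆ _ S∈) (inList uninfectedPts)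
      (λ e → not-true⇒false (proj₂ (∈-filter⁻ (λ y → not (I y) ≟ᵇ true) {xs = D} (memb⇒∈ _ e))))
    where
      open SideFour S
      open Grid {d} 2
      open Infection S

  family-size : ℕ → ℕ
  family-size d = length (subsets (grid d 2)) + length (stripIndices d)

  bad-event-bound : ∀ {d} → Fin d → ∀ m → 1 ≤ m → ∀ p → 0ℚ ℚ.≤ p → p ℚ.≤ 1ℚ →
    prob p (grid d m) (badEvent d m) ℚ.≤ fromℕ (suc (family-size d)) ℚ.* pow (1ℚ ℚ.- p) (4 * m)
  bad-event-bound {d} z m 1≤m p 0≤p p≤1 = bound-for m 1≤m
    where
      open Probability p 0≤p p≤1
      C = fromℕ (suc (family-size d))
      scale : ∀ {n} → n ≤ suc (family-size d) → ∀ k → fromℕ n ℚ.* pow q k ℚ.≤ C ℚ.* pow q k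
      scale {n} n≤ k = ℚ.*-monoʳ-≤-nonNeg (pow q k) {{ℚ.nonNegative (pow-nonNeg 0≤q k)}} (fromℕ-mono n≤)
      bound-for : ∀ m → 1 ≤ m → prob p (grid d m) (badEvent d m) ℚ.≤ C ℚ.* pow q (4 * m)
      bound-for 1 _ = begin
        prob p (grid d 1) (badEvent d 1)    ≤⟨ prob-mono (grid d 1) never-bad ⟩
        prob p (grid d 1) (λ _ → false)     ≡⟨ prob-false (grid d 1) ⟩
        0ℚ                                  ≡⟨ ℚ.*-zeroˡ (pow q 4) ⟨
        fromℕ 0 ℚ.* pow q 4                 ≤⟨ scale z≤n 4 ⟩
        C ℚ.* pow q 4                       ∎
        where
          open ℚ.≤-Reasoning
          never-bad : ∀ S → S ∈ subsets (grid d 1) → badEvent d 1 S ≡ true → false ≡ true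
          never-bad S _ bad = contradiction (trans (sym (side-two-cube-good z S)) (proj₁ (bad-parts d 1 S bad))) λ ()
      bound-for 2 _ = ℚ.≤-trans (union-bound inList (grid d 2) (badEvent d 2) (subsets (grid d 2)) (4 * 2) (small-side-witness z))
                             (scale (m≤n⇒m≤1+n (m≤m+n (length (subsets (grid d 2))) (length (stripIndices d)))) (4 * 2))
      bound-for (suc (suc (suc k))) _ =
        ℚ.≤-trans (union-bound (inStrip k) (grid d (3 + k)) (badEvent d (3 + k)) (stripIndices d) (4 * (3 + k))
                               (large-side-witness z k))
                  (scale (m≤n⇒m≤1+n (m≤n+m (length (stripIndices d)) (length (subsets (grid d 2))))) (4 * (3 + k)))

-- The development opens the ℕ operators _<_ and _*_, which the statement uses for ℚ, so the
-- statement's imports come after it.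
open import Defs
open import Data.Nat using (ℕ; _≤_)
open import Data.Product using (Σ; _×_)
open import Data.Rational using (ℚ; 0ℚ; 1ℚ; _*_; _-_; _<_) renaming (_≤_ to _≤ℚ_)
open import Data.Fin using (zero)
open import Data.Nat using (suc)
open import Data.Product using (_,_)
open import Data.Rational.Properties using (<⇒≤)
open BootstrapPercolation using (fromℕ; fromℕ-pos; family-size; bad-event-bound)

lemma4p8 : (d : ℕ) → 3 ≤ d →
    Σ ℚ (λ C → 0ℚ < C × ((m : ℕ) → 1 ≤ m → (p : ℚ) → 0ℚ < p → p < 1ℚ →
    prob p (grid d m) (badEvent d m) ≤ℚ C * pow (1ℚ - p) (4 Data.Nat.* m)))
lemma4p8 (suc d) _ = fromℕ (suc (family-size (suc d))) , fromℕ-pos (family-size (suc d)) ,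
  λ m 1≤m p 0<p p<1 → bad-event-bound zero m 1≤m p (<⇒≤ 0<p) (<⇒≤ p<1)
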